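{- For every $n$ divisible by $4$ there exists a distribution $\mathcal D_n$ over permutations of $[n]$ such that $\mathrm{val}_{\mathcal D_n}(\ast,\iota)=1$, but there is an absolute constant $C$ such that every deterministic comparison-based algorithm $\mathrm{ALG}$ whose stopping rule can be computed by circuits of size $2^{n/8}$ satisfies $\mathrm{val}_{\mathcal D_n}(\mathrm{ALG},\iota)\le C/n$.
   Context: Items are $[n]$. Nature draws an arrival order $\pi\sim\mathcal D_n$, where $\pi(i)$ is the arrival time of item $i$. The adversary's ordering of items by value is a permutation $\sigma$ of $[n]$, where $\sigma(j)$ is the item with the $j$-th largest value; $\iota$ denotes the identity permutation (item $1$ has the largest value, item $n$ the smallest). An online algorithm sees items in arrival order and at each time irrevocably decides whether to select the current item (at most one selection); comparison-based means the decision at time $t$ depends only on the relative order by value of the first $t$ arrived items. Its stopping rule is the function mapping this relative order (encoded, e.g., as the bit string of pairwise comparisons among the first $t$ items) to the decision at time $t$; it is computable by circuits of size $s$ if for each $t$ there is a Boolean circuit (AND/OR/NOT gates) of size at most $s$ computing it. $\mathrm{val}_{\mathcal D}(\mathrm{ALG},\sigma)$ is the probability that ALG selects the maximum-value item when values are ordered by $\sigma$ and $\pi\sim\mathcal D$; $\mathrm{val}_{\mathcal D}(\ast,\sigma)=\max_{\mathrm{ALG}}\mathrm{val}_{\mathcal D}(\mathrm{ALG},\sigma)$. -}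

module Defs where

open import Data.Nat as ℕ using (ℕ; zero; suc; _≤_; _^_; _<ᵇ_)
open import Data.Fin as Fin using (Fin; toℕ; inject≤)
open import Data.Fin.Properties using (toℕ<n)
import Data.Fin.Permutation
open import Data.Fin.Permutation using (Permutation′; _⟨$⟩ʳ_; _⟨$⟩ˡ_)
open import Data.Bool using (Bool; true; false; if_then_else_; _∧_; _∨_; not)
open import Data.Maybe using (Maybe; just; nothing)
import Data.Maybe as Maybe
open import Data.Vec using (Vec; []; _∷ʳ_; lookup)
open import Data.List using (List; []; _∷_; map)
open import Data.Product using (Σ; _×_; _,_; proj₁; proj₂)
open import Data.Rational as ℚ using (ℚ; 0ℚ; 1ℚ)
open import Data.List.Relation.Unary.All using (All)
open import Relation.Binary.PropositionalEquality using (_≡_)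

-- Boolean circuits (AND / OR / NOT gates, fan-in ≤ 2) over input
-- variables indexed by a type V, as straight-line programs.
-- The size of a circuit is its number of gates.

-- a wire available to a gate that has k earlier gates before it
data Wire (V : Set) (k : ℕ) : Set where
  var  : V → Wire V k
  gate : Fin k → Wire V k

data Gate (V : Set) (k : ℕ) : Set where
  AND : Wire V k → Wire V k → Gate V k
  OR  : Wire V k → Wire V k → Gate V k
  NOT : Wire V k → Gate V k

data Gates (V : Set) : ℕ → Set where
  []   : Gates V 0
  _▷_  : ∀ {k} → Gates V k → Gate V k → Gates V (suc k)

record Circuit (V : Set) : Set where
  constructor circuit
  field
    size   : ℕ
    gates  : Gates V size
    output : Wire V size

wireVal : ∀ {V k} → (V → Bool) → Vec Bool k → Wire V k → Bool
wireVal x g (var v)  = x v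
wireVal x g (gate i) = lookup g i

gateVal : ∀ {V k} → (V → Bool) → Vec Bool k → Gate V k → Bool
gateVal x g (AND a b) = wireVal x g a ∧ wireVal x g b
gateVal x g (OR a b)  = wireVal x g a ∨ wireVal x g b
gateVal x g (NOT a)   = not (wireVal x g a)

gateVals : ∀ {V k} → Gates V k → (V → Bool) → Vec Bool k
gateVals []       x = []
gateVals (gs ▷ g) x = let v = gateVals gs x in v ∷ʳ gateVal x v g

eval : ∀ {V} → Circuit V → (V → Bool) → Bool
eval (circuit s gs o) x = wireVal x (gateVals gs x) o

-- Time steps are m : Fin n (m = 0 is the first arrival); at time m the
-- algorithm has seen suc (toℕ m) items. The relative order of those items
-- is encoded by the bits  b j k  (j k : Fin (suc (toℕ m))), where
-- b j k = true iff the j-th arrived item has a larger value than the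
-- k-th arrived item.

Prefix : ∀ {n} → Fin n → Set
Prefix m = Fin (suc (toℕ m))

Comparisons : ∀ {n} → Fin n → Set
Comparisons m = Prefix m → Prefix m → Bool

-- stopping rule: decision (select current item?) at each time
Rule : ℕ → Set
Rule n = (m : Fin n) → Comparisons m → Bool

-- size bound  s ≤ 2^(n/8)  stated exactly over ℕ as  s^8 ≤ 2^n
ComputableBySize2^n/8 : ∀ {n} → Rule n → Set
ComputableBySize2^n/8 {n} A =
  (m : Fin n) → Σ (Circuit (Prefix m × Prefix m)) λ c →
     (Circuit.size c ^ 8 ≤ 2 ^ n) ×
     ((b : Comparisons m) → eval c (λ p → b (proj₁ p) (proj₂ p)) ≡ A m b)

-- Running the algorithm.
-- π ⟨$⟩ʳ i = π(i) is the arrival time of item i, so the item arriving at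
-- time t is π ⟨$⟩ˡ t. σ ⟨$⟩ʳ j = σ(j) is the item with the (j+1)-th largest
-- value, so the value-rank of item i is σ ⟨$⟩ˡ i (rank 0 = maximum).

rank : ∀ {n} → Permutation′ n → Fin n → ℕ
rank σ i = toℕ (σ ⟨$⟩ˡ i)

observed : ∀ {n} → Permutation′ n → Permutation′ n → (m : Fin n) → Comparisons m
observed {n} σ π m j k =
  rank σ (π ⟨$⟩ˡ inject≤ j (toℕ<n m)) <ᵇ rank σ (π ⟨$⟩ˡ inject≤ k (toℕ<n m))

firstTrue : ∀ {n} → (Fin n → Bool) → Maybe (Fin n)
firstTrue {zero}  f = nothing
firstTrue {suc n} f =
  if f Fin.zero then just Fin.zero
  else Maybe.map Fin.suc (firstTrue (λ i → f (Fin.suc i)))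

selectionTime : ∀ {n} → Rule n → Permutation′ n → Permutation′ n → Maybe (Fin n)
selectionTime A σ π = firstTrue (λ m → A m (observed σ π m))

success : ∀ {n} → Rule n → Permutation′ n → Permutation′ n → Bool
success A σ π with selectionTime A σ π
... | nothing = false
... | just t  = rank σ (π ⟨$⟩ˡ t) ℕ.≡ᵇ 0

sumℚ : List ℚ → ℚ
sumℚ []       = 0ℚ
sumℚ (q ∷ qs) = q ℚ.+ sumℚ qs

record Dist (n : ℕ) : Set where
  field
    support : List (Permutation′ n × ℚ)
    nonneg  : All (λ p → 0ℚ ℚ.≤ proj₂ p) support
    total   : sumℚ (map proj₂ support) ≡ 1ℚ

indicator : Bool → ℚ
indicator true  = 1ℚ
indicator false = 0ℚ

val : ∀ {n} → Dist n → Rule n → Permutation′ n → ℚ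
val D A σ = sumℚ (map (λ p → proj₂ p ℚ.* indicator (success A σ (proj₁ p)))
                      (Dist.support D))

ι : ∀ {n} → Permutation′ n
ι = Data.Fin.Permutation.id

module Submission where

-- The order π(x, τ), x ∈ {0,1}^p, τ < a = 2p, first presents a low items whose relative order encodes x,
-- then items of increasing value with the maximum arriving at time a + τ.  Until then the observations
-- do not depend on τ, so a rule can only win on π(x, τ) if, run on π(x, top), it stops at time a + τ:
-- its behaviour on x predicts τ.  D draws x uniformly and sets τ = g(x); knowing g one decodes x and
-- stops at a + g(x).  By the method of conditional expectations g can be chosen to agree with the
-- behaviour of every family of circuits of size 2^⌈p/2⌉ on few points, since there are few such families.

module Cube where

  open import Data.Nat
  open import Data.Nat.Properties
  open import Data.Bool using (Bool; true; false)
  open import Data.Vec using (Vec; []; _∷_)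
  open import Data.List using (List; []; _∷_; _++_; map)
  open import Data.List.Properties using (map-++)
  open import Data.List.Relation.Unary.All using (All; []; _∷_)
  open import Data.List.Relation.Unary.All.Properties using (++⁺)
  open import Relation.Binary.PropositionalEquality

  bit : Bool → ℕ
  bit true  = 1
  bit false = 0

  count : ∀ r → (Vec Bool r → Bool) → ℕ
  count zero    f = bit (f [])
  count (suc r) f = count r (λ x → f (true ∷ x)) + count r (λ x → f (false ∷ x))

  count-cong : ∀ r {f g : Vec Bool r → Bool} → (∀ x → f x ≡ g x) → count r f ≡ count r g
  count-cong zero    f≡g = cong bit (f≡g [])
  count-cong (suc r) f≡g = cong₂ _+_ (count-cong r (λ x → f≡g (true ∷ x))) (count-cong r (λ x → f≡g (false ∷ x)))

  count-mono : ∀ r {f g : Vec Bool r → Bool} → (∀ x → f x ≡ true → g x ≡ true) → count r f ≤ count r g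
  count-mono zero {f} {g} f⇒g = bit-mono (f []) (g []) (f⇒g [])
    where
    bit-mono : ∀ a b → (a ≡ true → b ≡ true) → bit a ≤ bit b
    bit-mono true  b a⇒b rewrite a⇒b refl = ≤-refl
    bit-mono false b a⇒b = z≤n
  count-mono (suc r) f⇒g = +-mono-≤ (count-mono r (λ x → f⇒g (true ∷ x))) (count-mono r (λ x → f⇒g (false ∷ x)))

  count-all : ∀ r → count r (λ _ → true) ≡ 2 ^ r
  count-all zero    = refl
  count-all (suc r) = trans (cong₂ _+_ (count-all r) (count-all r)) (cong (2 ^ r +_) (sym (+-identityʳ (2 ^ r))))

  count≤2^r : ∀ r f → count r f ≤ 2 ^ r
  count≤2^r r f = ≤-trans (count-mono r (λ _ _ → refl)) (≤-reflexive (count-all r))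

  cubeList : ∀ {A : Set} r → (Vec Bool r → A) → List A
  cubeList zero    f = f [] ∷ []
  cubeList (suc r) f = cubeList r (λ x → f (true ∷ x)) ++ cubeList r (λ x → f (false ∷ x))

  map-cubeList : ∀ {A B : Set} r (G : A → B) (f : Vec Bool r → A) → map G (cubeList r f) ≡ cubeList r (λ x → G (f x))
  map-cubeList zero    G f = refl
  map-cubeList (suc r) G f = trans (map-++ G (cubeList r (λ x → f (true ∷ x))) _) (cong₂ _++_ (map-cubeList r G _) (map-cubeList r G _))

  cubeList-cong : ∀ {A : Set} r {f f′ : Vec Bool r → A} → (∀ x → f x ≡ f′ x) → cubeList r f ≡ cubeList r f′
  cubeList-cong zero    f≗f′ = cong (_∷ []) (f≗f′ [])
  cubeList-cong (suc r) f≗f′ = cong₂ _++_ (cubeList-cong r (λ x → f≗f′ (true ∷ x))) (cubeList-cong r (λ x → f≗f′ (false ∷ x)))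

  all-cubeList : ∀ {A : Set} {P : A → Set} r (f : Vec Bool r → A) → (∀ x → P (f x)) → All P (cubeList r f)
  all-cubeList zero    f Pf = Pf [] ∷ []
  all-cubeList (suc r) f Pf = ++⁺ (all-cubeList r _ (λ x → Pf (true ∷ x))) (all-cubeList r _ (λ x → Pf (false ∷ x)))

module HardFunction where

  open Cube
  open import Data.Nat hiding (_≟_)
  open import Data.Nat.Properties hiding (_≟_)
  open import Algebra.Properties.Semiring.Sum +-*-semiring
    using (sum; sum-syntax; sum-cong-≗; sum-remove; ∑-comm; ∑-distrib-+; *-distribˡ-sum; sum-replicate-zero)
  open import Data.Bool using (Bool; true; false)
  open import Data.Maybe using (Maybe; just; nothing)
  open import Data.Fin using (Fin; zero; suc)
  open import Data.Fin.Properties using (_≟_)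
  open import Data.Vec using (Vec; []; _∷_)
  open import Data.Product using (Σ; _,_; proj₁; proj₂)
  open import Algebra.Properties.CommutativeSemigroup *-commutativeSemigroup using (xy∙z≈xz∙y)
  open import Relation.Nullary using (does; yes; no)
  open import Relation.Nullary.Decidable using (dec-true)
  open import Relation.Binary.PropositionalEquality

  averaging : ∀ {q} (c : Fin (suc q) → ℕ) → Σ (Fin (suc q)) λ v → suc q * c v ≤ sum c
  averaging {zero}  c = zero , ≤-refl
  averaging {suc q} c with averaging (λ i → c (suc i))
  ... | v , avg with c zero ≤? c (suc v)
  ...   | yes c₀≤ = zero , +-monoʳ-≤ (c zero) (≤-trans (*-monoʳ-≤ (suc q) c₀≤) avg)
  ...   | no  c₀≰ = suc v , +-mono-≤ (<⇒≤ (≰⇒> c₀≰)) avg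

  ∑-mono : ∀ {n} {f g : Fin n → ℕ} → (∀ i → f i ≤ g i) → sum f ≤ sum g
  ∑-mono {zero}  f≤g = z≤n
  ∑-mono {suc n} f≤g = +-mono-≤ (f≤g zero) (∑-mono (λ i → f≤g (suc i)))

  ∑-ones : ∀ M → ∑[ i < M ] 1 ≡ M
  ∑-ones zero    = refl
  ∑-ones (suc M) = cong suc (∑-ones M)

  term≤sum : ∀ {n} (f : Fin n → ℕ) i → f i ≤ sum f
  term≤sum {suc n} f i = ≤-trans (m≤m+n (f i) _) (≤-reflexive (sym (sum-remove f)))

  _hits_ : ∀ {q} → Maybe (Fin q) → Fin q → Bool
  nothing hits v = false
  just u  hits v = does (u ≟ v)

  hits-self : ∀ {q} (v : Fin q) → just v hits v ≡ true
  hits-self v = dec-true (v ≟ v) refl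

  hits-sound : ∀ {q} (y : Maybe (Fin q)) v → y hits v ≡ true → y ≡ just v
  hits-sound (just u) v hit with u ≟ v
  ... | yes refl = refl

  agreement : ∀ {r q} → (Vec Bool r → Maybe (Fin q)) → (Vec Bool r → Fin q) → ℕ
  agreement {r} h g = count r (λ x → h x hits g x)

  hits-atMostOne : ∀ {q} (y : Maybe (Fin q)) → ∑[ v < q ] bit (y hits v) ≤ 1
  hits-atMostOne {q} nothing = ≤-trans (≤-reflexive (sum-replicate-zero q)) z≤n
  hits-atMostOne (just u) = ≤-reflexive (hitsOnce u)
    where
    hitsOnce : ∀ {q} (u : Fin q) → ∑[ v < q ] bit (does (u ≟ v)) ≡ 1
    hitsOnce {suc q} zero    = cong suc (sum-replicate-zero q)
    hitsOnce         (suc u) = hitsOnce u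

  branch : ∀ {A : Set} {r} → (Vec Bool r → A) → (Vec Bool r → A) → Vec Bool (suc r) → A
  branch g₁ g₀ (true  ∷ x) = g₁ x
  branch g₁ g₀ (false ∷ x) = g₀ x

  potential : ∀ {M r q} → (Fin M → ℕ) → (Fin M → Vec Bool r → Maybe (Fin q)) → (Vec Bool r → Fin q) → ℕ
  potential {M} w h g = ∑[ i < M ] (w i * 2 ^ agreement (h i) g)

  potential-const : ∀ {M q} (w : Fin M → ℕ) (h : Fin M → Vec Bool 0 → Maybe (Fin q)) v →
    potential w h (λ _ → v) ≡ sum w + ∑[ i < M ] (w i * bit (h i [] hits v))
  potential-const w h v = trans (sum-cong-≗ (λ i → split (w i) (h i [] hits v))) (∑-distrib-+ w _)
    where
    split : ∀ m b → m * 2 ^ bit b ≡ m + m * bit b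
    split m true  = trans (*-comm m 2) (cong (m +_) (sym (*-comm m 1)))
    split m false = trans (*-identityʳ m) (sym (trans (cong (m +_) (*-zeroʳ m)) (+-identityʳ m)))

  potential-branch : ∀ {M r q} (w : Fin M → ℕ) (h : Fin M → Vec Bool (suc r) → Maybe (Fin q)) g₁ g₀ →
    potential w h (branch g₁ g₀)
      ≡ potential (λ i → w i * 2 ^ agreement (λ x → h i (true ∷ x)) g₁) (λ i x → h i (false ∷ x)) g₀
  potential-branch w h g₁ g₀ = sum-cong-≗ λ i →
    trans (cong (w i *_) (^-distribˡ-+-* 2 (agreement (λ x → h i (true ∷ x)) g₁) (agreement (λ x → h i (false ∷ x)) g₀)))
          (sym (*-assoc (w i) _ _))

  square : ∀ m r → m ^ (2 ^ suc r) ≡ m ^ (2 ^ r) * m ^ (2 ^ r)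
  square m r = trans (cong (m ^_) (cong (2 ^ r +_) (+-identityʳ (2 ^ r)))) (^-distribˡ-+-* m (2 ^ r) (2 ^ r))

  -- Hard functions exist (derandomised averaging): for every weighted family of predictions there is a
  -- g : {0,1}^r → Fin q whose potential is at most the total weight times (1 + 1/q)^(2^r), the average
  -- potential of a uniformly random g.  It is built one coordinate at a time, by the method of
  -- conditional expectations.
  hardFunction : ∀ {M q} r (w : Fin M → ℕ) (h : Fin M → Vec Bool r → Maybe (Fin (suc q))) →
    Σ (Vec Bool r → Fin (suc q)) λ g → potential w h g * suc q ^ (2 ^ r) ≤ sum w * suc (suc q) ^ (2 ^ r)
  hardFunction {M} {q} zero w h = (λ _ → v) , (begin
      potential w h (λ _ → v) * (suc q * 1)  ≡⟨ cong₂ _*_ (potential-const w h v) (*-identityʳ (suc q)) ⟩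
      (sum w + hitWeight v) * suc q          ≡⟨ *-distribʳ-+ (suc q) (sum w) (hitWeight v) ⟩
      sum w * suc q + hitWeight v * suc q    ≡⟨ cong (sum w * suc q +_) (*-comm (hitWeight v) (suc q)) ⟩
      sum w * suc q + suc q * hitWeight v    ≤⟨ +-monoʳ-≤ (sum w * suc q) (≤-trans v-avg total-hitWeight) ⟩
      sum w * suc q + sum w                  ≡⟨ +-comm (sum w * suc q) (sum w) ⟩
      sum w + sum w * suc q                  ≡˘⟨ *-suc (sum w) (suc q) ⟩
      sum w * suc (suc q)                    ≡˘⟨ cong (sum w *_) (*-identityʳ (suc (suc q))) ⟩
      sum w * (suc (suc q) * 1)              ∎)
    where
    open ≤-Reasoning
    hitWeight : Fin (suc q) → ℕ
    hitWeight v = ∑[ i < M ] (w i * bit (h i [] hits v))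
    v : Fin (suc q)
    v = proj₁ (averaging hitWeight)
    v-avg : suc q * hitWeight v ≤ sum hitWeight
    v-avg = proj₂ (averaging hitWeight)
    -- each prediction hits at most one value, so the hit weights add up to at most the total weight
    total-hitWeight : sum hitWeight ≤ sum w
    total-hitWeight = begin
      ∑[ v < suc q ] ∑[ i < M ] (w i * bit (h i [] hits v))  ≡⟨ ∑-comm (λ v i → w i * bit (h i [] hits v)) ⟩
      ∑[ i < M ] ∑[ v < suc q ] (w i * bit (h i [] hits v))  ≡˘⟨ sum-cong-≗ (λ i → *-distribˡ-sum (w i) (λ v → bit (h i [] hits v))) ⟩
      ∑[ i < M ] (w i * ∑[ v < suc q ] bit (h i [] hits v))  ≤⟨ ∑-mono (λ i → *-monoʳ-≤ (w i) (hits-atMostOne (h i []))) ⟩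
      ∑[ i < M ] (w i * 1)                                   ≡⟨ sum-cong-≗ (λ i → *-identityʳ (w i)) ⟩
      sum w                                                  ∎
  hardFunction {M} {q} (suc r) w h = branch g₁ g₀ , (begin
      potential w h (branch g₁ g₀) * suc q ^ (2 ^ suc r)  ≡⟨ cong₂ _*_ (potential-branch w h g₁ g₀) (square (suc q) r) ⟩
      potential w₀ h₀ g₀ * (Q * Q)                       ≡˘⟨ *-assoc (potential w₀ h₀ g₀) Q Q ⟩
      potential w₀ h₀ g₀ * Q * Q                         ≤⟨ *-monoˡ-≤ Q bound₀ ⟩
      potential w h₁ g₁ * P * Q                          ≡⟨ xy∙z≈xz∙y (potential w h₁ g₁) P Q ⟩
      potential w h₁ g₁ * Q * P                          ≤⟨ *-monoˡ-≤ P bound₁ ⟩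
      sum w * P * P                                      ≡⟨ *-assoc (sum w) P P ⟩
      sum w * (P * P)                                    ≡˘⟨ cong (sum w *_) (square (suc (suc q)) r) ⟩
      sum w * suc (suc q) ^ (2 ^ suc r)                  ∎)
    where
    open ≤-Reasoning
    Q P : ℕ
    Q = suc q ^ (2 ^ r)
    P = suc (suc q) ^ (2 ^ r)
    h₁ h₀ : Fin M → Vec Bool r → Maybe (Fin (suc q))
    h₁ i x = h i (true ∷ x)
    h₀ i x = h i (false ∷ x)
    -- first fix g on the half cube x₀ = 1, then on x₀ = 0 with the weights updated by the agreements so far
    g₁ : Vec Bool r → Fin (suc q)
    g₁ = proj₁ (hardFunction r w h₁)
    bound₁ : potential w h₁ g₁ * Q ≤ sum w * P
    bound₁ = proj₂ (hardFunction r w h₁)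
    w₀ : Fin M → ℕ
    w₀ i = w i * 2 ^ agreement (h₁ i) g₁
    g₀ : Vec Bool r → Fin (suc q)
    g₀ = proj₁ (hardFunction r w₀ h₀)
    bound₀ : potential w₀ h₀ g₀ * Q ≤ sum w₀ * P
    bound₀ = proj₂ (hardFunction r w₀ h₀)

  fewAgreements : ∀ {M q} r (h : Fin M → Vec Bool r → Maybe (Fin (suc q))) →
    Σ (Vec Bool r → Fin (suc q)) λ g →
      ∀ i → 2 ^ agreement (h i) g * suc q ^ (2 ^ r) ≤ M * suc (suc q) ^ (2 ^ r)
  fewAgreements {M} {q} r h = g , λ i → begin
      2 ^ agreement (h i) g * suc q ^ (2 ^ r)      ≡˘⟨ cong (_* suc q ^ (2 ^ r)) (*-identityˡ (2 ^ agreement (h i) g)) ⟩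
      1 * 2 ^ agreement (h i) g * suc q ^ (2 ^ r)  ≤⟨ *-monoˡ-≤ _ (term≤sum (λ j → 1 * 2 ^ agreement (h j) g) i) ⟩
      potential (λ _ → 1) h g * suc q ^ (2 ^ r)    ≤⟨ proj₂ (hardFunction r (λ _ → 1) h) ⟩
      ∑[ i < M ] 1 * suc (suc q) ^ (2 ^ r)         ≡⟨ cong (_* suc (suc q) ^ (2 ^ r)) (∑-ones M) ⟩
      M * suc (suc q) ^ (2 ^ r)                    ∎
    where
    open ≤-Reasoning
    g : Vec Bool r → Fin (suc q)
    g = proj₁ (hardFunction r (λ _ → 1) h)

module CircuitCount where

  open import Defs using (Wire; var; gate; Gate; AND; OR; NOT; Gates; []; _▷_; Circuit; circuit)
  open import Data.Nat
  open import Data.Nat.Properties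
  open import Data.Nat.Tactic.RingSolver using (solve-∀)
  open import Data.Fin using (Fin; zero; suc)
  open import Data.List using (List; []; _∷_; _++_; map; length; cartesianProductWith; allFin)
  open import Data.List.Properties using (length-++; length-map; length-tabulate)
  open import Data.List.Membership.Propositional using (_∈_)
  open import Data.List.Membership.Propositional.Properties
    using (∈-++⁺ˡ; ∈-++⁺ʳ; ∈-map⁺; ∈-cartesianProductWith⁺; ∈-allFin)
  open import Data.List.Relation.Unary.Any using (here)
  open import Data.Product using (Σ; _×_; _,_)
  open import Relation.Nullary using (yes; no)
  open import Relation.Binary.PropositionalEquality
  open import Algebra.Properties.CommutativeSemigroup *-commutativeSemigroup using (x∙yz≈y∙xz)

  length-cartesianProductWith : ∀ {A B C : Set} (f : A → B → C) xs ys →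
    length (cartesianProductWith f xs ys) ≡ length xs * length ys
  length-cartesianProductWith f []       ys = refl
  length-cartesianProductWith f (x ∷ xs) ys = trans (length-++ (map (f x) ys))
    (cong₂ _+_ (length-map (f x) ys) (length-cartesianProductWith f xs ys))

  extend : ∀ {n} {P : Fin (suc n) → Set} → P zero → ((i : Fin n) → P (suc i)) → (i : Fin (suc n)) → P i
  extend c f zero    = c
  extend c f (suc i) = f i

  choices : ∀ {n} {P : Fin n → Set} → ((i : Fin n) → List (P i)) → List ((i : Fin n) → P i)
  choices {zero}      Ls = (λ ()) ∷ []
  choices {suc n} {P} Ls = cartesianProductWith (extend {P = P}) (Ls zero) (choices (λ i → Ls (suc i)))

  choices-complete : ∀ {n} {P : Fin n → Set} (Ls : (i : Fin n) → List (P i)) (f : (i : Fin n) → P i) →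
    (∀ i → f i ∈ Ls i) → Σ ((i : Fin n) → P i) λ g → g ∈ choices Ls × (∀ i → g i ≡ f i)
  choices-complete {zero}      Ls f f∈ = (λ ()) , here refl , λ ()
  choices-complete {suc n} {P} Ls f f∈
    with choices-complete (λ i → Ls (suc i)) (λ i → f (suc i)) (λ i → f∈ (suc i))
  ... | g , g∈ , g≗f = extend {P = P} (f zero) g ,
        ∈-cartesianProductWith⁺ (extend {P = P}) (f∈ zero) g∈ , λ { zero → refl ; (suc i) → g≗f i }

  choices-length : ∀ {n} {P : Fin n → Set} (Ls : (i : Fin n) → List (P i)) L →
    (∀ i → length (Ls i) ≤ L) → length (choices Ls) ≤ L ^ n
  choices-length {zero}      Ls L short = ≤-refl
  choices-length {suc n} {P} Ls L short =
    ≤-trans (≤-reflexive (length-cartesianProductWith (extend {P = P}) (Ls zero) _))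
            (*-mono-≤ (short zero) (choices-length (λ i → Ls (suc i)) L (λ i → short (suc i))))

  module Enumeration {V : Set} (vs : List V) where

    wires : ∀ k → List (Wire V k)
    wires k = map var vs ++ map gate (allFin k)

    gates : ∀ k → List (Gate V k)
    gates k = cartesianProductWith AND (wires k) (wires k)
           ++ (cartesianProductWith OR (wires k) (wires k) ++ map NOT (wires k))

    gateLists : ∀ k → List (Gates V k)
    gateLists zero    = [] ∷ []
    gateLists (suc k) = cartesianProductWith _▷_ (gateLists k) (gates k)

    circuitsOfSize : ∀ k → List (Circuit V)
    circuitsOfSize k = cartesianProductWith (circuit k) (gateLists k) (wires k)

    circuitsUpTo : ℕ → List (Circuit V)
    circuitsUpTo zero    = circuitsOfSize zero
    circuitsUpTo (suc S) = circuitsOfSize (suc S) ++ circuitsUpTo S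

    module Completeness (listed : ∀ v → v ∈ vs) where

      wire∈ : ∀ {k} (u : Wire V k) → u ∈ wires k
      wire∈ (var v)      = ∈-++⁺ˡ (∈-map⁺ var (listed v))
      wire∈ {k} (gate i) = ∈-++⁺ʳ (map var vs) (∈-map⁺ gate (∈-allFin i))

      gate∈ : ∀ {k} (g : Gate V k) → g ∈ gates k
      gate∈ (AND u u′)    = ∈-++⁺ˡ (∈-cartesianProductWith⁺ AND (wire∈ u) (wire∈ u′))
      gate∈ {k} (OR u u′) = ∈-++⁺ʳ (cartesianProductWith AND (wires k) (wires k))
                              (∈-++⁺ˡ (∈-cartesianProductWith⁺ OR (wire∈ u) (wire∈ u′)))
      gate∈ {k} (NOT u)   = ∈-++⁺ʳ (cartesianProductWith AND (wires k) (wires k))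
                              (∈-++⁺ʳ (cartesianProductWith OR (wires k) (wires k)) (∈-map⁺ NOT (wire∈ u)))

      gateList∈ : ∀ {k} (gs : Gates V k) → gs ∈ gateLists k
      gateList∈ []       = here refl
      gateList∈ (gs ▷ g) = ∈-cartesianProductWith⁺ _▷_ (gateList∈ gs) (gate∈ g)

      circuit∈ : ∀ S (c : Circuit V) → Circuit.size c ≤ S → c ∈ circuitsUpTo S
      circuit∈ zero    (circuit .zero gs o) z≤n = ∈-cartesianProductWith⁺ (circuit 0) (gateList∈ gs) (wire∈ o)
      circuit∈ (suc S) (circuit k gs o) k≤ with k ≟ suc S
      ... | yes refl = ∈-++⁺ˡ (∈-cartesianProductWith⁺ (circuit (suc S)) (gateList∈ gs) (wire∈ o))
      ... | no  k≢   = ∈-++⁺ʳ (circuitsOfSize (suc S)) (circuit∈ S (circuit k gs o) (≤-pred (≤∧≢⇒< k≤ k≢)))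

    module Counting (B S : ℕ) (large : length vs + S + 1 ≤ B) where
      open ≤-Reasoning

      C : ℕ
      C = 4 * B * B

      wires-length : ∀ k → length (wires k) ≡ length vs + k
      wires-length k = trans (length-++ (map var vs))
        (cong₂ _+_ (length-map var vs) (trans (length-map gate (allFin k)) (length-tabulate (λ i → i))))

      wires≤B : ∀ k → k ≤ S → length (wires k) ≤ B
      wires≤B k k≤S = begin
        length (wires k)    ≡⟨ wires-length k ⟩
        length vs + k       ≤⟨ +-monoʳ-≤ (length vs) k≤S ⟩
        length vs + S       ≤⟨ m≤m+n (length vs + S) 1 ⟩
        length vs + S + 1   ≤⟨ large ⟩
        B                   ∎

      1≤B : 1 ≤ B
      1≤B = ≤-trans (m≤n+m 1 (length vs + S)) large

      1≤C : 1 ≤ C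
      1≤C = *-mono-≤ (*-mono-≤ (s≤s (z≤n {3})) 1≤B) 1≤B

      gates≤C : ∀ k → k ≤ S → length (gates k) ≤ C
      gates≤C k k≤S = begin
        length (gates k)                       ≡⟨ gates-length ⟩
        W * W + (W * W + W)                    ≤⟨ +-monoʳ-≤ (W * W) (+-monoʳ-≤ (W * W) (m≤m*m W)) ⟩
        W * W + (W * W + W * W)                ≤⟨ m≤m+n (W * W + (W * W + W * W)) (W * W) ⟩
        W * W + (W * W + W * W) + W * W        ≡⟨ four W ⟩
        4 * W * W                              ≤⟨ *-mono-≤ (*-monoʳ-≤ 4 W≤B) W≤B ⟩
        C                                      ∎
        where
        W : ℕ
        W = length (wires k)
        W≤B : W ≤ B
        W≤B = wires≤B k k≤S
        m≤m*m : ∀ m → m ≤ m * m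
        m≤m*m zero    = z≤n
        m≤m*m (suc m) = m≤m*n (suc m) (suc m)
        four : ∀ x → x * x + (x * x + x * x) + x * x ≡ 4 * x * x
        four = solve-∀
        gates-length : length (gates k) ≡ W * W + (W * W + W)
        gates-length = trans (length-++ (cartesianProductWith AND (wires k) (wires k)))
          (cong₂ _+_ (length-cartesianProductWith AND (wires k) (wires k))
            (trans (length-++ (cartesianProductWith OR (wires k) (wires k)))
              (cong₂ _+_ (length-cartesianProductWith OR (wires k) (wires k)) (length-map NOT (wires k)))))

      gateLists≤ : ∀ k → k ≤ S → length (gateLists k) ≤ C ^ k
      gateLists≤ zero    _   = ≤-refl
      gateLists≤ (suc k) k<S = begin
        length (gateLists (suc k))                  ≡⟨ length-cartesianProductWith _▷_ (gateLists k) (gates k) ⟩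
        length (gateLists k) * length (gates k)     ≤⟨ *-mono-≤ (gateLists≤ k k≤S) (gates≤C k k≤S) ⟩
        C ^ k * C                                   ≡⟨ *-comm (C ^ k) C ⟩
        C ^ suc k                                   ∎
        where
        k≤S : k ≤ S
        k≤S = ≤-trans (n≤1+n k) k<S

      circuitsOfSize≤ : ∀ k → k ≤ S → length (circuitsOfSize k) ≤ C ^ S * B
      circuitsOfSize≤ k k≤S = begin
        length (circuitsOfSize k)                  ≡⟨ length-cartesianProductWith (circuit k) (gateLists k) (wires k) ⟩
        length (gateLists k) * length (wires k)    ≤⟨ *-mono-≤ (gateLists≤ k k≤S) (wires≤B k k≤S) ⟩
        C ^ k * B                                  ≤⟨ *-monoˡ-≤ B (^-monoʳ-≤ C {{>-nonZero 1≤C}} k≤S) ⟩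
        C ^ S * B                                  ∎

      circuitsUpTo≤ : ∀ S′ → S′ ≤ S → length (circuitsUpTo S′) ≤ suc S′ * (C ^ S * B)
      circuitsUpTo≤ zero     S′≤S = ≤-trans (circuitsOfSize≤ zero S′≤S) (≤-reflexive (sym (+-identityʳ _)))
      circuitsUpTo≤ (suc S′) S′≤S = begin
        length (circuitsUpTo (suc S′))                                  ≡⟨ length-++ (circuitsOfSize (suc S′)) ⟩
        length (circuitsOfSize (suc S′)) + length (circuitsUpTo S′)     ≤⟨ +-mono-≤ (circuitsOfSize≤ (suc S′) S′≤S)
                                                                             (circuitsUpTo≤ S′ (≤-trans (n≤1+n S′) S′≤S)) ⟩
        suc (suc S′) * (C ^ S * B)                                      ∎

      circuitCount : length (circuitsUpTo S) ≤ C ^ suc S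
      circuitCount = begin
        length (circuitsUpTo S)   ≤⟨ circuitsUpTo≤ S ≤-refl ⟩
        suc S * (C ^ S * B)       ≤⟨ *-monoˡ-≤ (C ^ S * B) S<B ⟩
        B * (C ^ S * B)           ≡⟨ x∙yz≈y∙xz B (C ^ S) B ⟩
        C ^ S * (B * B)           ≤⟨ *-monoʳ-≤ (C ^ S) (≤-trans (m≤n*m (B * B) 4) (≤-reflexive (sym (*-assoc 4 B B)))) ⟩
        C ^ S * C                 ≡⟨ *-comm (C ^ S) C ⟩
        C ^ suc S                 ∎
        where
        S<B : suc S ≤ B
        S<B = ≤-trans (≤-reflexive (+-comm 1 S)) (≤-trans (m≤n+m (S + 1) (length vs))
                (≤-trans (≤-reflexive (sym (+-assoc (length vs) S 1))) large))

module Stopping where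

  open import Defs
  open import Data.Nat using (zero; suc; _<_; _≤_; z≤n; s≤s; _≡ᵇ_)
  open import Data.Nat.Properties using (≤-refl; <⇒≤; <-irrefl; ≡ᵇ⇒≡)
  open import Data.Bool using (Bool; true; false; T; _∧_; _∨_; not)
  open import Data.Maybe using (just; nothing)
  import Data.Maybe as Maybe
  open import Data.Fin using (Fin; zero; suc; toℕ)
  open import Data.Fin.Permutation using (_⟨$⟩ˡ_)
  open import Data.Vec using (Vec; _∷ʳ_)
  open import Data.Product using (Σ; _×_; _,_)
  open import Data.Empty using (⊥-elim)
  open import Relation.Binary.PropositionalEquality

  firstTrue-sound : ∀ {n} (f : Fin n → Bool) t → firstTrue f ≡ just t →
    f t ≡ true × (∀ m → toℕ m < toℕ t → f m ≡ false)
  firstTrue-sound {suc n} f t found with f zero in f₀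
  ... | true  with found
  ...   | refl = f₀ , λ m ()
  firstTrue-sound {suc n} f t found | false with firstTrue (λ i → f (suc i)) in found′
  ...   | just t′ with found
  ...     | refl with firstTrue-sound (λ i → f (suc i)) t′ found′
  ...       | ft , early = ft , λ { zero _ → f₀ ; (suc m) (s≤s m<t) → early m m<t }
  firstTrue-sound {suc n} f t () | false | nothing

  firstTrue-complete : ∀ {n} (f : Fin n → Bool) t → f t ≡ true → (∀ m → toℕ m < toℕ t → f m ≡ false) →
    firstTrue f ≡ just t
  firstTrue-complete {suc n} f zero    ft early rewrite ft = refl
  firstTrue-complete {suc n} f (suc t) ft early rewrite early zero (s≤s z≤n) =
    cong (Maybe.map suc) (firstTrue-complete (λ i → f (suc i)) t ft (λ m m<t → early (suc m) (s≤s m<t)))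

  firstTrue-unique : ∀ {n} (f : Fin n → Bool) t → f t ≡ true → (∀ m → f m ≡ true → m ≡ t) → firstTrue f ≡ just t
  firstTrue-unique f t ft only = firstTrue-complete f t ft early
    where
    early : ∀ m → toℕ m < toℕ t → f m ≡ false
    early m m<t with f m in fm
    ... | true  = ⊥-elim (<-irrefl (cong toℕ (only m fm)) m<t)
    ... | false = refl

  firstTrue-local : ∀ {n} (f f′ : Fin n → Bool) t → (∀ m → toℕ m ≤ toℕ t → f m ≡ f′ m) →
    firstTrue f ≡ just t → firstTrue f′ ≡ just t
  firstTrue-local f f′ t agree found with firstTrue-sound f t found
  ... | ft , early = firstTrue-complete f′ t (trans (sym (agree t ≤-refl)) ft)
                       (λ m m<t → trans (sym (agree m (<⇒≤ m<t))) (early m m<t))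

  firstTrue-cong : ∀ {n} {f f′ : Fin n → Bool} → (∀ m → f m ≡ f′ m) → firstTrue f ≡ firstTrue f′
  firstTrue-cong {zero}  f≗f′ = refl
  firstTrue-cong {suc n} {f} f≗f′ rewrite f≗f′ zero | firstTrue-cong {f = λ i → f (suc i)} (λ i → f≗f′ (suc i)) = refl

  success-inv : ∀ {n} (A : Rule n) σ π → success A σ π ≡ true →
    Σ (Fin n) λ t → selectionTime A σ π ≡ just t × rank σ (π ⟨$⟩ˡ t) ≡ 0
  success-inv A σ π succeeded with selectionTime A σ π
  ... | just t = t , refl , ≡ᵇ⇒≡ (rank σ (π ⟨$⟩ˡ t)) 0 (subst T (sym succeeded) _)

  success-at : ∀ {n} (A : Rule n) σ π t → selectionTime A σ π ≡ just t → success A σ π ≡ (rank σ (π ⟨$⟩ˡ t) ≡ᵇ 0)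
  success-at A σ π t selected with selectionTime A σ π
  success-at A σ π t refl | just .t = refl

  module _ {V : Set} {x y : V → Bool} (x≗y : ∀ v → x v ≡ y v) where

    wireVal-cong : ∀ {k} {g g′ : Vec Bool k} (u : Wire V k) → g ≡ g′ → wireVal x g u ≡ wireVal y g′ u
    wireVal-cong (var v)  refl = x≗y v
    wireVal-cong (gate i) refl = refl

    gateVal-cong : ∀ {k} {g g′ : Vec Bool k} (G : Gate V k) → g ≡ g′ → gateVal x g G ≡ gateVal y g′ G
    gateVal-cong (AND u u′) g≡g′ = cong₂ _∧_ (wireVal-cong u g≡g′) (wireVal-cong u′ g≡g′)
    gateVal-cong (OR u u′)  g≡g′ = cong₂ _∨_ (wireVal-cong u g≡g′) (wireVal-cong u′ g≡g′)
    gateVal-cong (NOT u)    g≡g′ = cong not (wireVal-cong u g≡g′)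

    gateVals-cong : ∀ {k} (gs : Gates V k) → gateVals gs x ≡ gateVals gs y
    gateVals-cong []       = refl
    gateVals-cong (gs ▷ G) = cong₂ _∷ʳ_ (gateVals-cong gs) (gateVal-cong G (gateVals-cong gs))

    eval-cong : (c : Circuit V) → eval c x ≡ eval c y
    eval-cong (circuit s gs o) = wireVal-cong o (gateVals-cong gs)

module HardInstance where

  open import Defs
  open HardFunction using (_hits_; hits-self; hits-sound)
  open Stopping
  open import Data.Nat hiding (_≟_)
  open import Data.Nat.Properties hiding (_≟_)
  open import Data.Bool using (Bool; true; false; if_then_else_; T)
  open import Data.Bool.Properties using (¬-not; T-≡)
  open import Data.Maybe using (Maybe; just; nothing; _>>=_)
  open import Data.Maybe.Properties using (just-injective)
  open import Data.Sum using (_⊎_; inj₁; inj₂; [_,_]′; swap)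
  import Data.Sum as Sum
  open import Data.Fin using (Fin; zero; suc; toℕ; fromℕ; fromℕ<; inject≤; _↑ˡ_; _↑ʳ_; splitAt; join)
  open import Data.Fin.Properties
    using (_≟_; toℕ-↑ˡ; toℕ-↑ʳ; toℕ<n; toℕ-fromℕ; toℕ-fromℕ<; toℕ-inject≤; toℕ-injective;
           splitAt-↑ˡ; splitAt-↑ʳ; splitAt⁻¹-↑ˡ; splitAt⁻¹-↑ʳ; splitAt-join; join-splitAt)
  open import Data.Fin.Permutation using (Permutation′; permutation; _⟨$⟩ˡ_)
  open import Data.Vec using (Vec; lookup; tabulate)
  open import Data.Vec.Properties using (tabulate-cong; tabulate∘lookup)
  open import Data.Product using (_×_; _,_; proj₁; proj₂)
  open import Data.Empty using (⊥-elim)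
  open import Function using (_∘_; Equivalence)
  open import Relation.Nullary using (Dec; yes; no; ¬_)
  open import Relation.Binary.PropositionalEquality

  <ᵇ-cong : ∀ {m n m′ n′} → (m < n → m′ < n′) → (m′ < n′ → m < n) → (m <ᵇ n) ≡ (m′ <ᵇ n′)
  <ᵇ-cong {m} {n} {m′} {n′} to from with m <ᵇ n in e | m′ <ᵇ n′ in e′
  ... | true  | true  = refl
  ... | false | false = refl
  ... | true  | false = ⊥-elim (subst T e′ (<⇒<ᵇ (to (<ᵇ⇒< m n (subst T (sym e) _)))))
  ... | false | true  = ⊥-elim (subst T e (<⇒<ᵇ (from (<ᵇ⇒< m′ n′ (subst T (sym e′) _)))))

  <ᵇ-true : ∀ {m n} → m < n → (m <ᵇ n) ≡ true
  <ᵇ-true m<n = Equivalence.to T-≡ (<⇒<ᵇ m<n)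

  <ᵇ-false : ∀ {m n} → n ≤ m → (m <ᵇ n) ≡ false
  <ᵇ-false {m} {n} n≤m = ¬-not (λ m<ᵇn → <⇒≱ (<ᵇ⇒< m n (subst T (sym m<ᵇn) _)) n≤m)

  cap : ℕ → (b : ℕ) → Fin (suc b)
  cap zero    b       = zero
  cap (suc x) zero    = zero
  cap (suc x) (suc b) = suc (cap x b)

  toℕ-cap : ∀ x b → x ≤ b → toℕ (cap x b) ≡ x
  toℕ-cap zero    b       _         = refl
  toℕ-cap (suc x) (suc b) (s≤s x≤b) = cong suc (toℕ-cap x b x≤b)

  data Half (m : ℕ) : Fin (m + m) → Set where
    left  : (i : Fin m) → Half m (i ↑ˡ m)
    right : (i : Fin m) → Half m (m ↑ʳ i)

  half : ∀ m t → Half m t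
  half m t with splitAt m t in eq
  ... | inj₁ i = subst (Half m) (splitAt⁻¹-↑ˡ eq) (left i)
  ... | inj₂ i = subst (Half m) (splitAt⁻¹-↑ʳ eq) (right i)

  onHalves : ∀ {m} → (Fin m ⊎ Fin m → Fin m ⊎ Fin m) → Fin (m + m) → Fin (m + m)
  onHalves {m} φ t = join m m (φ (splitAt m t))

  onHalves-inverse : ∀ {m} (φ ψ : Fin m ⊎ Fin m → Fin m ⊎ Fin m) → (∀ s → φ (ψ s) ≡ s) →
    ∀ t → onHalves φ (onHalves ψ t) ≡ t
  onHalves-inverse {m} φ ψ φ∘ψ t = begin
    join m m (φ (splitAt m (join m m (ψ (splitAt m t)))))  ≡⟨ cong (join m m ∘ φ) (splitAt-join m m (ψ (splitAt m t))) ⟩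
    join m m (φ (ψ (splitAt m t)))                          ≡⟨ cong (join m m) (φ∘ψ (splitAt m t)) ⟩
    join m m (splitAt m t)                                  ≡⟨ join-splitAt m m t ⟩
    t                                                       ∎
    where open ≡-Reasoning

  crossing : ∀ {m} → (Fin m → Fin m) → (Fin m → Fin m) → Fin (m + m) → Fin (m + m)
  crossing f g = onHalves (swap ∘ Sum.map f g)

  crossing-inverse : ∀ {m} (f g : Fin m → Fin m) → (∀ i → f (f i) ≡ i) → (∀ i → g (g i) ≡ i) →
    ∀ t → crossing g f (crossing f g t) ≡ t
  crossing-inverse f g f-inv g-inv = onHalves-inverse (swap ∘ Sum.map g f) (swap ∘ Sum.map f g) undo
    where
    undo : ∀ s → swap (Sum.map g f (swap (Sum.map f g s))) ≡ s
    undo (inj₁ i) = cong inj₁ (f-inv i)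
    undo (inj₂ i) = cong inj₂ (g-inv i)

  -- Items are identified with their value ranks (σ = ι, item 0 is the maximum).
  module Instance (k : ℕ) where

    p a n : ℕ
    p = suc k
    a = p + p
    n = a + a

    -- encoding x ∈ {0,1}^p: the involution of Fin a exchanging i and p + i exactly when xᵢ = 0
    exchangeIf : Vec Bool p → Fin p ⊎ Fin p → Fin p ⊎ Fin p
    exchangeIf x (inj₁ i) = if lookup x i then inj₁ i else inj₂ i
    exchangeIf x (inj₂ i) = if lookup x i then inj₂ i else inj₁ i

    exchangeIf-involutive : ∀ x s → exchangeIf x (exchangeIf x s) ≡ s
    exchangeIf-involutive x (inj₁ i) with lookup x i in xᵢ
    ... | true  rewrite xᵢ = refl
    ... | false rewrite xᵢ = refl
    exchangeIf-involutive x (inj₂ i) with lookup x i in xᵢ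
    ... | true  rewrite xᵢ = refl
    ... | false rewrite xᵢ = refl

    encode : Vec Bool p → Fin a → Fin a
    encode x = onHalves (exchangeIf x)

    encode-involutive : ∀ x i → encode x (encode x i) ≡ i
    encode-involutive x = onHalves-inverse (exchangeIf x) (exchangeIf x) (exchangeIf-involutive x)

    encode-bit : ∀ x i → (toℕ (encode x (i ↑ˡ p)) <ᵇ toℕ (encode x (p ↑ʳ i))) ≡ lookup x i
    encode-bit x i rewrite splitAt-↑ˡ p i p | splitAt-↑ʳ p p i with lookup x i
    ... | true  = <ᵇ-true (subst₂ _<_ (sym (toℕ-↑ˡ i p)) (sym (toℕ-↑ʳ p i)) (m<n+m (toℕ i) z<s))
    ... | false = <ᵇ-false (subst₂ _≤_ (sym (toℕ-↑ˡ i p)) (sym (toℕ-↑ʳ p i)) (m≤n+m (toℕ i) p))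

    reflectBelow : Fin a → Fin a → Fin a
    reflectBelow τ w with toℕ w ≤? toℕ τ
    ... | yes _ = fromℕ< (≤-<-trans (m∸n≤m (toℕ τ) (toℕ w)) (toℕ<n τ))
    ... | no  _ = w

    reflectBelow-≤ : ∀ τ w → toℕ w ≤ toℕ τ → toℕ (reflectBelow τ w) ≡ toℕ τ ∸ toℕ w
    reflectBelow-≤ τ w w≤τ with toℕ w ≤? toℕ τ
    ... | yes _   = toℕ-fromℕ< _
    ... | no  w≰τ = ⊥-elim (w≰τ w≤τ)

    reflectBelow-> : ∀ τ w → ¬ toℕ w ≤ toℕ τ → reflectBelow τ w ≡ w
    reflectBelow-> τ w w≰τ with toℕ w ≤? toℕ τ
    ... | yes w≤τ = ⊥-elim (w≰τ w≤τ)
    ... | no  _   = refl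

    reflectBelow-involutive : ∀ τ w → reflectBelow τ (reflectBelow τ w) ≡ w
    reflectBelow-involutive τ w = byCases (toℕ w ≤? toℕ τ)
      where
      open ≡-Reasoning
      byCases : Dec (toℕ w ≤ toℕ τ) → reflectBelow τ (reflectBelow τ w) ≡ w
      byCases (no  w≰τ) = trans (cong (reflectBelow τ) (reflectBelow-> τ w w≰τ)) (reflectBelow-> τ w w≰τ)
      byCases (yes w≤τ) = toℕ-injective (begin
        toℕ (reflectBelow τ (reflectBelow τ w))  ≡⟨ reflectBelow-≤ τ (reflectBelow τ w) reflected≤τ ⟩
        toℕ τ ∸ toℕ (reflectBelow τ w)           ≡⟨ cong (toℕ τ ∸_) (reflectBelow-≤ τ w w≤τ) ⟩
        toℕ τ ∸ (toℕ τ ∸ toℕ w)                  ≡⟨ m∸[m∸n]≡n w≤τ ⟩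
        toℕ w                                    ∎)
        where
        reflected≤τ : toℕ (reflectBelow τ w) ≤ toℕ τ
        reflected≤τ = subst (_≤ toℕ τ) (sym (reflectBelow-≤ τ w w≤τ)) (m∸n≤m (toℕ τ) (toℕ w))

    -- π(x, τ): at times 0 … a-1 the items a … 2a-1 arrive in the order encoding x; at times a + w the
    -- items τ, τ-1, …, 0 arrive (the maximum at time a + τ), followed by the items τ+1, …, a-1
    itemAt : Vec Bool p → Fin a → Fin n → Fin n
    itemAt x τ = crossing (encode x) (reflectBelow τ)

    arrival : Vec Bool p → Fin a → Permutation′ n
    arrival x τ = permutation (crossing (reflectBelow τ) (encode x)) (itemAt x τ)
      (crossing-inverse (encode x) (reflectBelow τ) (encode-involutive x) (reflectBelow-involutive τ))
      (crossing-inverse (reflectBelow τ) (encode x) (reflectBelow-involutive τ) (encode-involutive x))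

    valueRank : Vec Bool p → Fin a → Fin n → ℕ
    valueRank x τ t = rank ι (arrival x τ ⟨$⟩ˡ t)

    rank-encoding : ∀ x τ i → valueRank x τ (i ↑ˡ a) ≡ a + toℕ (encode x i)
    rank-encoding x τ i = trans (cong (λ s → toℕ (join a a (swap (Sum.map (encode x) (reflectBelow τ) s)))) (splitAt-↑ˡ a i a))
                                (toℕ-↑ʳ a (encode x i))

    rank-window : ∀ x τ w → valueRank x τ (a ↑ʳ w) ≡ toℕ (reflectBelow τ w)
    rank-window x τ w = trans (cong (λ s → toℕ (join a a (swap (Sum.map (encode x) (reflectBelow τ) s)))) (splitAt-↑ʳ a a w))
                              (toℕ-↑ˡ (reflectBelow τ w) a)

    rank-window-≤ : ∀ x τ w → toℕ w ≤ toℕ τ → valueRank x τ (a ↑ʳ w) ≡ toℕ τ ∸ toℕ w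
    rank-window-≤ x τ w w≤τ = trans (rank-window x τ w) (reflectBelow-≤ τ w w≤τ)

    -- the relative order observed before the maximum arrives: encoding items are mutually ordered by the
    -- encoding, lie below all window items, and window items increase in value over time
    phasePattern : Vec Bool p → Fin a ⊎ Fin a → Fin a ⊎ Fin a → Bool
    phasePattern x (inj₁ i) (inj₁ j) = toℕ (encode x i) <ᵇ toℕ (encode x j)
    phasePattern x (inj₁ i) (inj₂ w) = false
    phasePattern x (inj₂ v) (inj₁ j) = true
    phasePattern x (inj₂ v) (inj₂ w) = toℕ w <ᵇ toℕ v

    window≤ : ∀ (τ w : Fin a) → toℕ (a ↑ʳ w) ≤ a + toℕ τ → toℕ w ≤ toℕ τ
    window≤ τ w bound = +-cancelˡ-≤ a (toℕ w) (toℕ τ) (subst (_≤ a + toℕ τ) (toℕ-↑ʳ a w) bound)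

    window<a : ∀ (τ w : Fin a) → toℕ τ ∸ toℕ w < a
    window<a τ w = ≤-<-trans (m∸n≤m (toℕ τ) (toℕ w)) (toℕ<n τ)

    beforeMax-pattern : ∀ x τ t₁ t₂ → toℕ t₁ ≤ a + toℕ τ → toℕ t₂ ≤ a + toℕ τ →
      (valueRank x τ t₁ <ᵇ valueRank x τ t₂) ≡ phasePattern x (splitAt a t₁) (splitAt a t₂)
    beforeMax-pattern x τ t₁ t₂ b₁ b₂ with half a t₁ | half a t₂
    ... | left i  | left j  = begin
      valueRank x τ (i ↑ˡ a) <ᵇ valueRank x τ (j ↑ˡ a)      ≡⟨ cong₂ _<ᵇ_ (rank-encoding x τ i) (rank-encoding x τ j) ⟩
      a + toℕ (encode x i) <ᵇ a + toℕ (encode x j)          ≡⟨ <ᵇ-cong (+-cancelˡ-< a _ _) (+-monoʳ-< a) ⟩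
      toℕ (encode x i) <ᵇ toℕ (encode x j)                  ≡˘⟨ cong₂ (phasePattern x) (splitAt-↑ˡ a i a) (splitAt-↑ˡ a j a) ⟩
      phasePattern x (splitAt a (i ↑ˡ a)) (splitAt a (j ↑ˡ a)) ∎
      where open ≡-Reasoning
    ... | left i  | right w = begin
      valueRank x τ (i ↑ˡ a) <ᵇ valueRank x τ (a ↑ʳ w)      ≡⟨ cong₂ _<ᵇ_ (rank-encoding x τ i) (rank-window-≤ x τ w (window≤ τ w b₂)) ⟩
      a + toℕ (encode x i) <ᵇ toℕ τ ∸ toℕ w                 ≡⟨ <ᵇ-false (≤-trans (<⇒≤ (window<a τ w)) (m≤m+n a _)) ⟩
      false                                                 ≡˘⟨ cong₂ (phasePattern x) (splitAt-↑ˡ a i a) (splitAt-↑ʳ a a w) ⟩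
      phasePattern x (splitAt a (i ↑ˡ a)) (splitAt a (a ↑ʳ w)) ∎
      where open ≡-Reasoning
    ... | right v | left j  = begin
      valueRank x τ (a ↑ʳ v) <ᵇ valueRank x τ (j ↑ˡ a)      ≡⟨ cong₂ _<ᵇ_ (rank-window-≤ x τ v (window≤ τ v b₁)) (rank-encoding x τ j) ⟩
      toℕ τ ∸ toℕ v <ᵇ a + toℕ (encode x j)                 ≡⟨ <ᵇ-true (<-≤-trans (window<a τ v) (m≤m+n a _)) ⟩
      true                                                  ≡˘⟨ cong₂ (phasePattern x) (splitAt-↑ʳ a a v) (splitAt-↑ˡ a j a) ⟩
      phasePattern x (splitAt a (a ↑ʳ v)) (splitAt a (j ↑ˡ a)) ∎
      where open ≡-Reasoning
    ... | right v | right w = begin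
      valueRank x τ (a ↑ʳ v) <ᵇ valueRank x τ (a ↑ʳ w)      ≡⟨ cong₂ _<ᵇ_ (rank-window-≤ x τ v v≤τ) (rank-window-≤ x τ w (window≤ τ w b₂)) ⟩
      toℕ τ ∸ toℕ v <ᵇ toℕ τ ∸ toℕ w                        ≡⟨ <ᵇ-cong ∸-cancelʳ-< (λ w<v → ∸-monoʳ-< w<v v≤τ) ⟩
      toℕ w <ᵇ toℕ v                                        ≡˘⟨ cong₂ (phasePattern x) (splitAt-↑ʳ a a v) (splitAt-↑ʳ a a w) ⟩
      phasePattern x (splitAt a (a ↑ʳ v)) (splitAt a (a ↑ʳ w)) ∎
      where
      open ≡-Reasoning
      v≤τ : toℕ v ≤ toℕ τ
      v≤τ = window≤ τ v b₁

    -- the last window position: π(x, top) postpones the maximum as long as possible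
    top : Fin a
    top = fromℕ (k + suc k)

    τ≤top : ∀ (τ : Fin a) → toℕ τ ≤ toℕ top
    τ≤top τ = subst (toℕ τ ≤_) (sym (toℕ-fromℕ (k + suc k))) (≤-pred (toℕ<n τ))

    indistinguishable : ∀ x τ (m : Fin n) → toℕ m ≤ a + toℕ τ → ∀ j l →
      observed ι (arrival x τ) m j l ≡ observed ι (arrival x top) m j l
    indistinguishable x τ m m≤ j l =
      trans (beforeMax-pattern x τ _ _ (earlier j) (earlier l))
            (sym (beforeMax-pattern x top _ _ (later j) (later l)))
      where
      earlier : (j : Prefix m) → toℕ (inject≤ j (toℕ<n m)) ≤ a + toℕ τ
      earlier j = subst (_≤ a + toℕ τ) (sym (toℕ-inject≤ j (toℕ<n m))) (≤-trans (≤-pred (toℕ<n j)) m≤)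
      later : (j : Prefix m) → toℕ (inject≤ j (toℕ<n m)) ≤ a + toℕ top
      later j = ≤-trans (earlier j) (+-monoʳ-≤ a (τ≤top τ))

    maximum-rank : ∀ x τ → valueRank x τ (a ↑ʳ τ) ≡ 0
    maximum-rank x τ = trans (rank-window-≤ x τ τ ≤-refl) (n∸n≡0 (toℕ τ))

    maximum-time : ∀ x τ t → valueRank x τ t ≡ 0 → t ≡ a ↑ʳ τ
    maximum-time x τ t rank0 with half a t
    ... | left i  = ⊥-elim (1+n≢0 (trans (sym (rank-encoding x τ i)) rank0))
    ... | right w with toℕ w ≤? toℕ τ
    ...   | yes w≤τ = cong (a ↑ʳ_) (toℕ-injective (≤-antisym w≤τ
                        (m∸n≡0⇒m≤n (trans (sym (rank-window-≤ x τ w w≤τ)) rank0))))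
    ...   | no  w≰τ = ⊥-elim (w≰τ (subst (_≤ toℕ τ) (sym w≡0) z≤n))
      where
      w≡0 : toℕ w ≡ 0
      w≡0 = trans (cong toℕ (sym (reflectBelow-> τ w w≰τ))) (trans (sym (rank-window x τ w)) rank0)

    -- reading x off the comparisons of the first a arrivals (meaningful from time a on)
    decode : (m : Fin n) → Comparisons m → Vec Bool p
    decode m b = tabulate λ i → b (cap (toℕ i) (toℕ m)) (cap (p + toℕ i) (toℕ m))

    cap-earlier : ∀ (m s : Fin n) t → toℕ s ≡ t → t ≤ toℕ m → inject≤ (cap t (toℕ m)) (toℕ<n m) ≡ s
    cap-earlier m s t s≡t t≤m = toℕ-injective (trans (toℕ-inject≤ _ (toℕ<n m)) (trans (toℕ-cap t (toℕ m) t≤m) (sym s≡t)))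

    decode-correct : ∀ x τ m → a ≤ toℕ m → decode m (observed ι (arrival x τ) m) ≡ x
    decode-correct x τ m a≤m = trans (tabulate-cong bitᵢ) (tabulate∘lookup x)
      where
      open ≡-Reasoning
      bitᵢ : ∀ i → observed ι (arrival x τ) m (cap (toℕ i) (toℕ m)) (cap (p + toℕ i) (toℕ m)) ≡ lookup x i
      bitᵢ i = begin
        observed ι (arrival x τ) m (cap (toℕ i) (toℕ m)) (cap (p + toℕ i) (toℕ m))
          ≡⟨ cong₂ (λ s s′ → valueRank x τ s <ᵇ valueRank x τ s′)
               (cap-earlier m ((i ↑ˡ p) ↑ˡ a) (toℕ i) (trans (toℕ-↑ˡ (i ↑ˡ p) a) (toℕ-↑ˡ i p)) i≤m)
               (cap-earlier m ((p ↑ʳ i) ↑ˡ a) (p + toℕ i) (trans (toℕ-↑ˡ (p ↑ʳ i) a) (toℕ-↑ʳ p i)) p+i≤m) ⟩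
        valueRank x τ ((i ↑ˡ p) ↑ˡ a) <ᵇ valueRank x τ ((p ↑ʳ i) ↑ˡ a)
          ≡⟨ cong₂ _<ᵇ_ (rank-encoding x τ (i ↑ˡ p)) (rank-encoding x τ (p ↑ʳ i)) ⟩
        a + toℕ (encode x (i ↑ˡ p)) <ᵇ a + toℕ (encode x (p ↑ʳ i))
          ≡⟨ <ᵇ-cong (+-cancelˡ-< a _ _) (+-monoʳ-< a) ⟩
        toℕ (encode x (i ↑ˡ p)) <ᵇ toℕ (encode x (p ↑ʳ i))
          ≡⟨ encode-bit x i ⟩
        lookup x i ∎
        where
        p+i≤m : p + toℕ i ≤ toℕ m
        p+i≤m = ≤-trans (<⇒≤ (+-monoʳ-< p (toℕ<n i))) a≤m
        i≤m : toℕ i ≤ toℕ m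
        i≤m = ≤-trans (m≤n+m (toℕ i) p) p+i≤m

    windowPos : Fin n → Maybe (Fin a)
    windowPos t = [ (λ _ → nothing) , just ]′ (splitAt a t)

    windowPos-left : ∀ i → windowPos (i ↑ˡ a) ≡ nothing
    windowPos-left i = cong [ (λ _ → nothing) , just ]′ (splitAt-↑ˡ a i a)

    windowPos-right : ∀ w → windowPos (a ↑ʳ w) ≡ just w
    windowPos-right w = cong [ (λ _ → nothing) , just ]′ (splitAt-↑ʳ a a w)

    informed : (Vec Bool p → Fin a) → Rule n
    informed g m b = windowPos m hits g (decode m b)

    informed-succeeds : ∀ g x → success (informed g) ι (arrival x (g x)) ≡ true
    informed-succeeds g x = trans (success-at (informed g) ι π t₀ selected) (cong (_≡ᵇ 0) (maximum-rank x (g x)))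
      where
      π : Permutation′ n
      π = arrival x (g x)
      t₀ : Fin n
      t₀ = a ↑ʳ g x
      decides : Fin n → Bool
      decides m = informed g m (observed ι π m)
      decoded : ∀ w → decode (a ↑ʳ w) (observed ι π (a ↑ʳ w)) ≡ x
      decoded w = decode-correct x (g x) (a ↑ʳ w) (subst (a ≤_) (sym (toℕ-↑ʳ a w)) (m≤m+n a (toℕ w)))
      stops : decides t₀ ≡ true
      stops = trans (cong₂ _hits_ (windowPos-right (g x)) (cong g (decoded (g x)))) (hits-self (g x))
      only : ∀ m → decides m ≡ true → m ≡ t₀
      only m stop with half a m
      ... | left i  = ⊥-elim (false≢true (trans (sym (cong (λ y → y hits g (decode (i ↑ˡ a) (observed ι π (i ↑ˡ a)))) (windowPos-left i))) stop))
        where false≢true : false ≢ true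
              false≢true ()
      ... | right w = cong (a ↑ʳ_) (just-injective (hits-sound (just w) (g x)
                        (trans (cong (just w hits_) (cong g (sym (decoded w))))
                               (trans (sym (cong (_hits g (decode (a ↑ʳ w) (observed ι π (a ↑ʳ w)))) (windowPos-right w))) stop))))
      selected : selectionTime (informed g) ι π ≡ just t₀
      selected = firstTrue-unique decides t₀ stops only

    Family : Set
    Family = (m : Fin n) → Circuit (Prefix m × Prefix m)

    Computes : Family → Rule n → Set
    Computes cs A = ∀ m (b : Comparisons m) → eval (cs m) (λ v → b (proj₁ v) (proj₂ v)) ≡ A m b

    decisions : Family → Permutation′ n → Fin n → Bool
    decisions cs π m = eval (cs m) (λ v → observed ι π m (proj₁ v) (proj₂ v))

    -- the window position at which a family stops on π(x, top); by indistinguishability this is the only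
    -- τ for which its rule can succeed on π(x, τ)
    behaviour : Family → Vec Bool p → Maybe (Fin a)
    behaviour cs x = firstTrue (decisions cs (arrival x top)) >>= windowPos

    behaviour-cong : ∀ {cs cs′} → (∀ m → cs m ≡ cs′ m) → ∀ x → behaviour cs x ≡ behaviour cs′ x
    behaviour-cong cs≗cs′ x = cong (_>>= windowPos)
      (firstTrue-cong (λ m → cong (λ c → eval c (λ v → observed ι (arrival x top) m (proj₁ v) (proj₂ v))) (cs≗cs′ m)))

    -- a rule computed by a family can only succeed on π(x, τ) when the behaviour of the family on x is τ:
    -- it selects at time a + τ, and its decisions up to then are those of the family on π(x, top)
    success⇒predicted : ∀ {cs A} → Computes cs A → ∀ x τ → success A ι (arrival x τ) ≡ true → behaviour cs x hits τ ≡ true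
    success⇒predicted {cs} {A} computes x τ succeeded with success-inv A ι (arrival x τ) succeeded
    ... | t , selected , rank0 with maximum-time x τ t rank0
    ... | refl = subst (λ y → (y >>= windowPos) hits τ ≡ true) (sym stopsAtMax)
                   (trans (cong (_hits τ) (windowPos-right τ)) (hits-self τ))
      where
      sameDecisions : ∀ m → toℕ m ≤ toℕ (a ↑ʳ τ) → A m (observed ι (arrival x τ) m) ≡ decisions cs (arrival x top) m
      sameDecisions m m≤ = trans (sym (computes m (observed ι (arrival x τ) m)))
        (eval-cong (λ v → indistinguishable x τ m (subst (toℕ m ≤_) (toℕ-↑ʳ a τ) m≤) (proj₁ v) (proj₂ v)) (cs m))
      stopsAtMax : firstTrue (decisions cs (arrival x top)) ≡ just (a ↑ʳ τ)
      stopsAtMax = firstTrue-local _ _ (a ↑ʳ τ) sameDecisions selected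

module Growth where

  open import Data.Nat
  open import Data.Nat.Properties
  open import Data.Nat.Tactic.RingSolver using (solve-∀)
  open import Data.Unit using (tt)
  open import Relation.Nullary using (yes; no)
  open import Data.Empty using (⊥-elim)
  open import Relation.Binary.PropositionalEquality
  open import Algebra.Properties.CommutativeSemigroup *-commutativeSemigroup using (x∙yz≈y∙xz; xy∙z≈y∙xz)

  open ≤-Reasoning

  strictMono-reflects-≤ : (f : ℕ → ℕ) → (∀ {x y} → x < y → f x < f y) → ∀ {x y} → f x ≤ f y → x ≤ y
  strictMono-reflects-≤ f mono {x} {y} fx≤fy with x ≤? y
  ... | yes x≤y = x≤y
  ... | no  x≰y = ⊥-elim (<⇒≱ (mono (≰⇒> x≰y)) fx≤fy)

  ⌈n/2⌉≤1+⌊n/2⌋ : ∀ n → ⌈ n /2⌉ ≤ suc ⌊ n /2⌋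
  ⌈n/2⌉≤1+⌊n/2⌋ zero          = z≤n
  ⌈n/2⌉≤1+⌊n/2⌋ (suc zero)    = ≤-refl
  ⌈n/2⌉≤1+⌊n/2⌋ (suc (suc n)) = s≤s (⌈n/2⌉≤1+⌊n/2⌋ n)

  -- (1 + 1/q)^j ≤ q / (q - j):  precisely  (q+1)^j · d ≤ q^j · q  whenever j + d = q
  powerRatio : ∀ q j d → j + d ≡ q → suc q ^ j * d ≤ q ^ j * q
  powerRatio q zero    d refl = ≤-refl
  powerRatio q (suc j) d j+d≡q = begin
    suc q * suc q ^ j * d    ≡⟨ xy∙z≈y∙xz (suc q) (suc q ^ j) d ⟩
    suc q ^ j * (suc q * d)  ≤⟨ *-monoʳ-≤ (suc q ^ j) q+1·d≤q·d+1 ⟩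
    suc q ^ j * (q * suc d)  ≡⟨ x∙yz≈y∙xz (suc q ^ j) q (suc d) ⟩
    q * (suc q ^ j * suc d)  ≤⟨ *-monoʳ-≤ q (powerRatio q j (suc d) (trans (+-suc j d) j+d≡q)) ⟩
    q * (q ^ j * q)          ≡˘⟨ *-assoc q (q ^ j) q ⟩
    q * q ^ j * q            ∎
    where
    d≤q : d ≤ q
    d≤q = subst (d ≤_) j+d≡q (m≤n+m d (suc j))
    q+1·d≤q·d+1 : suc q * d ≤ q * suc d
    q+1·d≤q·d+1 = subst (suc q * d ≤_) (sym (*-suc q d)) (+-monoˡ-≤ (q * d) d≤q)

  halfRatio : ∀ p .{{_ : NonZero p}} j → j ≤ p → suc (p + p) ^ j ≤ 2 * (p + p) ^ j
  halfRatio p j j≤p = *-cancelʳ-≤ _ _ p (begin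
    suc (p + p) ^ j * p               ≤⟨ *-monoʳ-≤ (suc (p + p) ^ j) (m≤n+m p (p ∸ j)) ⟩
    suc (p + p) ^ j * (p ∸ j + p)     ≤⟨ powerRatio (p + p) j (p ∸ j + p) split ⟩
    (p + p) ^ j * (p + p)             ≡⟨ double ((p + p) ^ j) p ⟩
    2 * (p + p) ^ j * p               ∎)
    where
    double : ∀ x p → x * (p + p) ≡ 2 * x * p
    double = solve-∀
    split : j + (p ∸ j + p) ≡ p + p
    split = trans (sym (+-assoc j (p ∸ j) p)) (cong (_+ p) (m+[n∸m]≡n j≤p))

  -- (1 + 1/(2p))^N ≤ 2^c  whenever N ≤ p·c: split N into c blocks of length at most p
  blockRatio : ∀ p .{{_ : NonZero p}} c N → N ≤ p * c → suc (p + p) ^ N ≤ 2 ^ c * (p + p) ^ N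
  blockRatio p zero N N≤0 with n≤0⇒n≡0 (subst (N ≤_) (*-zeroʳ p) N≤0)
  ... | refl = ≤-refl
  blockRatio p (suc c) N N≤ with N ≤? p
  ... | yes N≤p = ≤-trans (halfRatio p N N≤p) (*-monoˡ-≤ ((p + p) ^ N) (*-monoʳ-≤ 2 (m^n>0 2 c)))
  ... | no  N≰p = subst (λ z → suc (p + p) ^ z ≤ 2 ^ suc c * (p + p) ^ z) (m+[n∸m]≡n p≤N) (begin
    suc (p + p) ^ (p + R)                      ≡⟨ ^-distribˡ-+-* (suc (p + p)) p R ⟩
    suc (p + p) ^ p * suc (p + p) ^ R          ≤⟨ *-mono-≤ (halfRatio p p ≤-refl) (blockRatio p c R R≤) ⟩
    (2 * (p + p) ^ p) * (2 ^ c * (p + p) ^ R)  ≡⟨ interchange 2 ((p + p) ^ p) (2 ^ c) ((p + p) ^ R) ⟩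
    (2 * 2 ^ c) * ((p + p) ^ p * (p + p) ^ R)  ≡˘⟨ cong ((2 * 2 ^ c) *_) (^-distribˡ-+-* (p + p) p R) ⟩
    2 ^ suc c * (p + p) ^ (p + R)              ∎)
    where
    interchange : ∀ a b c d → (a * b) * (c * d) ≡ (a * c) * (b * d)
    interchange = solve-∀
    R : ℕ
    R = N ∸ p
    p≤N : p ≤ N
    p≤N = <⇒≤ (≰⇒> N≰p)
    R≤ : R ≤ p * c
    R≤ = begin
      N ∸ p            ≤⟨ ∸-monoˡ-≤ p N≤ ⟩
      p * suc c ∸ p    ≡⟨ cong (_∸ p) (*-suc p c) ⟩
      p + p * c ∸ p    ≡⟨ m+n∸m≡n p (p * c) ⟩
      p * c            ∎

  sixthPowerStep : ∀ m → 12 ≤ m → suc m ^ 6 ≤ 2 * m ^ 6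
  sixthPowerStep m 12≤m = *-cancelʳ-≤ _ _ d {{>-nonZero 0<d}} (begin
    suc m ^ 6 * d    ≤⟨ powerRatio m 6 d (m+[n∸m]≡n 6≤m) ⟩
    m ^ 6 * m        ≤⟨ *-monoʳ-≤ (m ^ 6) m≤2d ⟩
    m ^ 6 * (2 * d)  ≡⟨ x∙yz≈y∙xz (m ^ 6) 2 d ⟩
    2 * (m ^ 6 * d)  ≡˘⟨ *-assoc 2 (m ^ 6) d ⟩
    2 * m ^ 6 * d    ∎)
    where
    d : ℕ
    d = m ∸ 6
    6≤m : 6 ≤ m
    6≤m = ≤-trans (≤ᵇ⇒≤ 6 12 tt) 12≤m
    6≤d : 6 ≤ d
    6≤d = ∸-monoˡ-≤ 6 12≤m
    0<d : 0 < d
    0<d = ≤-trans (s≤s z≤n) 6≤d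
    m≤2d : m ≤ 2 * d
    m≤2d = begin
      m          ≡˘⟨ m+[n∸m]≡n 6≤m ⟩
      6 + d      ≤⟨ +-monoˡ-≤ d 6≤d ⟩
      d + d      ≡˘⟨ cong (d +_) (+-identityʳ d) ⟩
      2 * d      ∎

  polyBelowExp : ∀ p → 64 ≤ p → 2 ^ 14 * (p + 3) ^ 6 ≤ 2 ^ p
  polyBelowExp p 64≤p = subst₂ (λ u v → 2 ^ 14 * u ^ 6 ≤ 2 ^ v) shift (m∸n+n≡m 64≤p) (fromBase (p ∸ 64))
    where
    shift : p ∸ 64 + 67 ≡ p + 3
    shift = trans (sym (+-assoc (p ∸ 64) 64 3)) (cong (_+ 3) (m∸n+n≡m 64≤p))
    fromBase : ∀ t → 2 ^ 14 * (t + 67) ^ 6 ≤ 2 ^ (t + 64)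
    fromBase zero    = ≤ᵇ⇒≤ (2 ^ 14 * 67 ^ 6) (2 ^ 64) tt
    fromBase (suc t) = begin
      2 ^ 14 * suc (t + 67) ^ 6    ≤⟨ *-monoʳ-≤ (2 ^ 14) (sixthPowerStep (t + 67) (≤-trans (≤ᵇ⇒≤ 12 67 tt) (m≤n+m 67 t))) ⟩
      2 ^ 14 * (2 * (t + 67) ^ 6)  ≡⟨ x∙yz≈y∙xz (2 ^ 14) 2 ((t + 67) ^ 6) ⟩
      2 * (2 ^ 14 * (t + 67) ^ 6)  ≤⟨ *-monoʳ-≤ 2 (fromBase t) ⟩
      2 * 2 ^ (t + 64)             ∎

module Fractions where

  open import Defs using (sumℚ; indicator)
  open Cube using (bit; count; cubeList)
  open import Data.Nat as ℕ using (ℕ; zero; suc)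
  import Data.Nat.Properties as ℕ
  open import Data.Nat.Tactic.RingSolver using (solve-∀)
  open import Data.Bool using (Bool; true; false)
  open import Data.Vec using (Vec; []; _∷_)
  open import Data.Integer as ℤ using (+_; +≤+)
  import Data.Integer.Properties as ℤ
  open import Data.Rational as ℚ using (0ℚ; 1ℚ; _/_; toℚᵘ)
  import Data.Rational.Properties as ℚ
  open import Data.Rational.Unnormalised as ℚᵘ using (mkℚᵘ; *≡*; *≤*)
  import Data.Rational.Unnormalised.Properties as ℚᵘ
  open import Data.List using ([]; _∷_; _++_)
  open import Relation.Binary.PropositionalEquality

  sumℚ-++ : ∀ xs ys → sumℚ (xs ++ ys) ≡ sumℚ xs ℚ.+ sumℚ ys
  sumℚ-++ []       ys = sym (ℚ.+-identityˡ (sumℚ ys))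
  sumℚ-++ (x ∷ xs) ys = trans (cong (x ℚ.+_) (sumℚ-++ xs ys)) (sym (ℚ.+-assoc x (sumℚ xs) (sumℚ ys)))

  unnormalise : ∀ a d → toℚᵘ (+ a / suc d) ℚᵘ.≃ mkℚᵘ (+ a) d
  unnormalise a d = ℚ.toℚᵘ-fromℚᵘ (mkℚᵘ (+ a) d)

  frac-+ : ∀ a b d → (+ a / suc d) ℚ.+ (+ b / suc d) ≡ + (a ℕ.+ b) / suc d
  frac-+ a b d = ℚ.toℚᵘ-injective (ℚᵘ.≃-trans (ℚ.toℚᵘ-homo-+ (+ a / suc d) (+ b / suc d))
    (ℚᵘ.≃-trans (ℚᵘ.+-cong (unnormalise a d) (unnormalise b d))
    (ℚᵘ.≃-trans sameDenominator (ℚᵘ.≃-sym (unnormalise (a ℕ.+ b) d)))))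
    where
    D : ℕ
    D = suc d
    distrib : ∀ a b D → (a ℕ.* D ℕ.+ b ℕ.* D) ℕ.* D ≡ (a ℕ.+ b) ℕ.* (D ℕ.* D)
    distrib = solve-∀
    sameDenominator : (mkℚᵘ (+ a) d ℚᵘ.+ mkℚᵘ (+ b) d) ℚᵘ.≃ mkℚᵘ (+ (a ℕ.+ b)) d
    sameDenominator = *≡* (begin
      (+ a ℤ.* + D ℤ.+ + b ℤ.* + D) ℤ.* + D  ≡˘⟨ cong (ℤ._* + D) (cong₂ ℤ._+_ (ℤ.pos-* a D) (ℤ.pos-* b D)) ⟩
      (+ (a ℕ.* D) ℤ.+ + (b ℕ.* D)) ℤ.* + D  ≡˘⟨ ℤ.pos-* (a ℕ.* D ℕ.+ b ℕ.* D) D ⟩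
      + ((a ℕ.* D ℕ.+ b ℕ.* D) ℕ.* D)       ≡⟨ cong +_ (distrib a b D) ⟩
      + ((a ℕ.+ b) ℕ.* (D ℕ.* D))           ≡⟨ ℤ.pos-* (a ℕ.+ b) (D ℕ.* D) ⟩
      + (a ℕ.+ b) ℤ.* + (D ℕ.* D)           ∎)
      where open ≡-Reasoning

  frac-≤ : ∀ a b d e → a ℕ.* suc e ℕ.≤ b ℕ.* suc d → (+ a / suc d) ℚ.≤ (+ b / suc e)
  frac-≤ a b d e cross = ℚ.toℚᵘ-cancel-≤ (ℚᵘ.≤-respˡ-≃ (ℚᵘ.≃-sym (unnormalise a d)) (ℚᵘ.≤-respʳ-≃ (ℚᵘ.≃-sym (unnormalise b e))
    (*≤* (subst₂ ℤ._≤_ (ℤ.pos-* a (suc e)) (ℤ.pos-* b (suc d)) (+≤+ cross)))))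

  frac-self : ∀ d → + suc d / suc d ≡ 1ℚ
  frac-self d = ℚ.toℚᵘ-injective (ℚᵘ.≃-trans (unnormalise (suc d) d)
    (*≡* (trans (sym (ℤ.pos-* (suc d) 1)) (trans (cong +_ (ℕ.*-comm (suc d) 1)) (ℤ.pos-* 1 (suc d))))))

  unit-nonneg : ∀ d → 0ℚ ℚ.≤ (+ 1 / suc d)
  unit-nonneg d = ℚ.toℚᵘ-cancel-≤ (ℚᵘ.≤-respʳ-≃ (ℚᵘ.≃-sym (unnormalise 1 d)) (*≤* (+≤+ ℕ.z≤n)))

  weighted-indicator : ∀ d b → (+ 1 / suc d) ℚ.* indicator b ≡ + bit b / suc d
  weighted-indicator d true  = ℚ.*-identityʳ (+ 1 / suc d)
  weighted-indicator d false = trans (ℚ.*-zeroʳ (+ 1 / suc d)) (sym (ℚ.0/n≡0 (suc d)))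

  sum-cubeList : ∀ d r (s : Vec Bool r → Bool) → sumℚ (cubeList r (λ x → + bit (s x) / suc d)) ≡ + count r s / suc d
  sum-cubeList d zero    s = ℚ.+-identityʳ (+ bit (s []) / suc d)
  sum-cubeList d (suc r) s = trans (sumℚ-++ (cubeList r (λ x → + bit (s (true ∷ x)) / suc d)) _)
    (trans (cong₂ ℚ._+_ (sum-cubeList d r (λ x → s (true ∷ x))) (sum-cubeList d r (λ x → s (false ∷ x))))
           (frac-+ (count r (λ x → s (true ∷ x))) (count r (λ x → s (false ∷ x))) d))

open import Defs
open import Data.Nat as ℕ hiding (_/_; _≤_; _≟_)
open import Data.Nat.Properties hiding (_≟_)
open import Data.Nat.DivMod using (_%_; m≡m%n+[m/n]*n; m%n<n; m/n*n≤m) renaming (_/_ to _div_)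
open import Data.Nat.Tactic.RingSolver using (solve-∀)
open import Data.Bool using (Bool; true)
open import Data.Maybe using (Maybe)
open import Data.Fin using (Fin; toℕ)
open import Data.Fin.Properties using (toℕ<n)
open import Data.Fin.Permutation using (Permutation′)
open import Data.Vec using (Vec)
open import Data.List using (List; map; length; lookup; allFin; cartesianProduct)
open import Data.List.Properties using (length-tabulate)
open import Data.List.Relation.Unary.Any using (index)
open import Data.List.Relation.Unary.Any.Properties using (lookup-index)
open import Data.List.Membership.Propositional using (_∈_)
open import Data.List.Membership.Propositional.Properties using (∈-cartesianProduct⁺; ∈-allFin)
open import Data.Integer using (+_)
open import Data.Rational as ℚ using (ℚ; 1ℚ; _/_)
open import Data.Product using (Σ; _×_; _,_; proj₁; proj₂)
open import Relation.Nullary using (yes; no; ¬_)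
open import Function using (case_of_)
open import Relation.Binary.PropositionalEquality
open Cube
open HardFunction using (_hits_; agreement; fewAgreements)
open CircuitCount
open HardInstance
open Growth
open Fractions

module Construction (k : ℕ) where
  open Instance k

  -- the number N = 2^p of instances, written N-1 + 1 to serve as a denominator
  N N-1 : ℕ
  N   = 2 ^ p
  N-1 = pred N

  1+N-1≡N : suc N-1 ≡ N
  1+N-1≡N = suc-pred N {{m^n≢0 2 p}}

  -- rules computable by circuits of size 2^(n/8) are computable by circuits of size S = 2^⌈p/2⌉
  h S : ℕ
  h = ⌈ p /2⌉
  S = 2 ^ h

  size-bound : ∀ s → s ^ 8 ℕ.≤ 2 ^ n → s ℕ.≤ S
  size-bound s s⁸≤2ⁿ = strictMono-reflects-≤ (_^ 8) (^-monoˡ-< 8) (begin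
    s ^ 8         ≤⟨ s⁸≤2ⁿ ⟩
    2 ^ n         ≤⟨ ^-monoʳ-≤ 2 n≤8h ⟩
    2 ^ (h * 8)   ≡˘⟨ ^-*-assoc 2 h 8 ⟩
    S ^ 8         ∎)
    where
    open ≤-Reasoning
    p≤h+h : p ℕ.≤ h + h
    p≤h+h = subst (ℕ._≤ h + h) (⌊n/2⌋+⌈n/2⌉≡n p) (+-monoˡ-≤ h (⌊n/2⌋≤⌈n/2⌉ p))
    eightfold : ∀ p h → p ℕ.≤ h + h → (p + p) + (p + p) ℕ.≤ h * 8
    eightfold p h le = subst ((p + p) + (p + p) ℕ.≤_) (ring h) (+-mono-≤ (+-mono-≤ le le) (+-mono-≤ le le))
      where ring : ∀ h → (h + h + (h + h)) + (h + h + (h + h)) ≡ h * 8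
            ring = solve-∀
    n≤8h : n ℕ.≤ h * 8
    n≤8h = eightfold p h p≤h+h

  variables : (m : Fin n) → List (Prefix m × Prefix m)
  variables m = cartesianProduct (allFin (suc (toℕ m))) (allFin (suc (toℕ m)))

  variables-complete : ∀ m v → v ∈ variables m
  variables-complete m (i , j) = ∈-cartesianProduct⁺ (∈-allFin i) (∈-allFin j)

  circuitsAt : (m : Fin n) → List (Circuit (Prefix m × Prefix m))
  circuitsAt m = Enumeration.circuitsUpTo (variables m) S

  families : List Family
  families = choices circuitsAt

  M : ℕ
  M = length families

  predictor : Fin M → Vec Bool p → Maybe (Fin a)
  predictor i = behaviour (lookup families i)

  g : Vec Bool p → Fin a
  g = proj₁ (fewAgreements p predictor)

  weight : ℚ
  weight = + 1 / suc N-1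

  support : List (Permutation′ n × ℚ)
  support = cubeList p (λ x → arrival x (g x) , weight)

  total : sumℚ (map proj₂ support) ≡ 1ℚ
  total = begin
    sumℚ (map proj₂ support)                   ≡⟨ cong sumℚ (map-cubeList p proj₂ (λ x → arrival x (g x) , weight)) ⟩
    sumℚ (cubeList p (λ x → + bit true / suc N-1)) ≡⟨ sum-cubeList N-1 p (λ _ → true) ⟩
    + count p (λ _ → true) / suc N-1           ≡⟨ cong (λ z → + z / suc N-1) (trans (count-all p) (sym 1+N-1≡N)) ⟩
    + suc N-1 / suc N-1                        ≡⟨ frac-self N-1 ⟩
    1ℚ                                         ∎
    where open ≡-Reasoning

  D : Dist n
  D = record
    { support = support
    ; nonneg  = all-cubeList p (λ x → arrival x (g x) , weight) (λ x → unit-nonneg N-1)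
    ; total   = total
    }

  successes : Rule n → ℕ
  successes A = count p (λ x → success A ι (arrival x (g x)))

  val-successes : ∀ A → val D A ι ≡ + successes A / suc N-1
  val-successes A = begin
    val D A ι
      ≡⟨ cong sumℚ (map-cubeList p (λ s → proj₂ s ℚ.* indicator (success A ι (proj₁ s))) (λ x → arrival x (g x) , weight)) ⟩
    sumℚ (cubeList p (λ x → weight ℚ.* indicator (success A ι (arrival x (g x)))))
      ≡⟨ cong sumℚ (cubeList-cong p (λ x → weighted-indicator N-1 (success A ι (arrival x (g x))))) ⟩
    sumℚ (cubeList p (λ x → + bit (success A ι (arrival x (g x))) / suc N-1))
      ≡⟨ sum-cubeList N-1 p (λ x → success A ι (arrival x (g x))) ⟩
    + successes A / suc N-1 ∎
    where open ≡-Reasoning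

  informed-perfect : val D (informed g) ι ≡ 1ℚ
  informed-perfect = begin
    val D (informed g) ι                 ≡⟨ val-successes (informed g) ⟩
    + successes (informed g) / suc N-1   ≡⟨ cong (λ z → + z / suc N-1) everywhere ⟩
    + suc N-1 / suc N-1                  ≡⟨ frac-self N-1 ⟩
    1ℚ                                   ∎
    where
    open ≡-Reasoning
    everywhere : successes (informed g) ≡ suc N-1
    everywhere = trans (count-cong p (informed-succeeds g)) (trans (count-all p) (sym 1+N-1≡N))

  small-rule-predicted : ∀ A → ComputableBySize2^n/8 A → Σ (Fin M) λ i → successes A ℕ.≤ agreement (predictor i) g
  small-rule-predicted A computable = index f∈ , (begin
    successes A                                ≤⟨ count-mono p (λ x → success⇒predicted {cs} {A} computes x (g x)) ⟩
    count p (λ x → behaviour cs x hits g x)    ≡⟨ count-cong p (λ x → cong (_hits g x) (behaviour-cong f≗cs′ x)) ⟩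
    agreement (predictor (index f∈)) g         ∎)
    where
    open ≤-Reasoning
    cs : Family
    cs m = proj₁ (computable m)
    computes : Computes cs A
    computes m = proj₂ (proj₂ (computable m))
    listed : ∀ m → cs m ∈ circuitsAt m
    listed m = Enumeration.Completeness.circuit∈ (variables m) (variables-complete m) S (cs m)
                 (size-bound _ (proj₁ (proj₂ (computable m))))
    chosen : Σ Family λ f → f ∈ families × (∀ m → f m ≡ cs m)
    chosen = choices-complete circuitsAt cs listed
    f : Family
    f = proj₁ chosen
    f∈ : f ∈ families
    f∈ = proj₁ (proj₂ chosen)
    f≗cs′ : ∀ m → cs m ≡ lookup families (index f∈) m
    f≗cs′ m = trans (sym (proj₂ (proj₂ chosen) m)) (cong (λ c → c m) (lookup-index f∈))

  module Large (64≤p : 64 ℕ.≤ p) where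
    open ≤-Reasoning

    e B λ′ c : ℕ
    e  = p + 3
    B  = 2 ^ (p + 2)
    λ′ = (e + e) * suc S
    c  = N div p + 1

    poly : 2 ^ 14 * e ^ 6 ℕ.≤ N
    poly = polyBelowExp p 64≤p

    p≤e : p ℕ.≤ e
    p≤e = m≤m+n p 3

    16p²≤N : 16 * p * p ℕ.≤ N
    16p²≤N = ≤-trans (subst (ℕ._≤ 2 ^ 14 * e ^ 6) (sym (*-assoc 16 p p)) (*-mono-≤ (≤ᵇ⇒≤ 16 (2 ^ 14) _) p²≤e⁶)) poly
      where
      p²≤e⁶ : p * p ℕ.≤ e ^ 6
      p²≤e⁶ = ≤-trans (*-mono-≤ p≤e p≤e) (*-monoʳ-≤ e (m≤m*n e (e ^ 4) {{m^n≢0 e 4}}))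

    S²≤2N : S * S ℕ.≤ 2 * N
    S²≤2N = begin
      S * S          ≡˘⟨ ^-distribˡ-+-* 2 h h ⟩
      2 ^ (h + h)    ≤⟨ ^-monoʳ-≤ 2 h+h≤1+p ⟩
      2 ^ suc p      ∎
      where
      h+h≤1+p : h + h ℕ.≤ suc p
      h+h≤1+p = subst (h + h ℕ.≤_) (cong suc (⌊n/2⌋+⌈n/2⌉≡n p)) (+-monoˡ-≤ h (⌈n/2⌉≤1+⌊n/2⌋ p))

    B≡4N : B ≡ 4 * N
    B≡4N = trans (^-distribˡ-+-* 2 p 2) (*-comm N 4)

    fits : ∀ m → length (variables m) + S + 1 ℕ.≤ B
    fits m = begin
      length (variables m) + S + 1  ≤⟨ +-mono-≤ (+-mono-≤ variables≤N (^-monoʳ-≤ 2 (⌈n/2⌉≤n p))) (m^n>0 2 p) ⟩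
      N + N + N                    ≤⟨ m≤m+n (N + N + N) N ⟩
      N + N + N + N                ≡⟨ fourfold N ⟩
      4 * N                        ≡˘⟨ B≡4N ⟩
      B                            ∎
      where
      fourfold : ∀ x → x + x + x + x ≡ 4 * x
      fourfold = solve-∀
      sixteen : ∀ p → ((p + p) + (p + p)) * ((p + p) + (p + p)) ≡ 16 * p * p
      sixteen = solve-∀
      variables≤N : length (variables m) ℕ.≤ N
      variables≤N = begin
        length (variables m)                    ≡⟨ length-cartesianProductWith _,_ (allFin (suc (toℕ m))) (allFin (suc (toℕ m))) ⟩
        length (allFin (suc (toℕ m))) * length (allFin (suc (toℕ m)))
                                                ≡⟨ cong₂ _*_ (length-tabulate {n = suc (toℕ m)} (λ i → i)) (length-tabulate {n = suc (toℕ m)} (λ i → i)) ⟩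
        suc (toℕ m) * suc (toℕ m)               ≤⟨ *-mono-≤ (toℕ<n m) (toℕ<n m) ⟩
        n * n                                   ≡⟨ sixteen p ⟩
        16 * p * p                              ≤⟨ 16p²≤N ⟩
        N                                       ∎

    circuitsAt-length : ∀ m → length (circuitsAt m) ℕ.≤ 2 ^ λ′
    circuitsAt-length m = begin
      length (circuitsAt m)      ≤⟨ Enumeration.Counting.circuitCount (variables m) B S (fits m) ⟩
      (4 * B * B) ^ suc S        ≡⟨ cong (_^ suc S) 4B²≡ ⟩
      (2 ^ (e + e)) ^ suc S      ≡⟨ ^-*-assoc 2 (e + e) (suc S) ⟩
      2 ^ λ′                     ∎
      where
      exponents : ∀ p → 2 + (p + 2) + (p + 2) ≡ (p + 3) + (p + 3)
      exponents = solve-∀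
      4B²≡ : 4 * B * B ≡ 2 ^ (e + e)
      4B²≡ = trans (cong (_* B) (sym (^-distribˡ-+-* 2 2 (p + 2))))
               (trans (sym (^-distribˡ-+-* 2 (2 + (p + 2)) (p + 2))) (cong (2 ^_) (exponents p)))

    M≤ : M ℕ.≤ 2 ^ (λ′ * n)
    M≤ = ≤-trans (choices-length circuitsAt (2 ^ λ′) circuitsAt-length) (≤-reflexive (^-*-assoc 2 λ′ n))

    N≤pc : N ℕ.≤ p * c
    N≤pc = begin
      N                          ≡⟨ m≡m%n+[m/n]*n N p ⟩
      N % p + N div p * p        ≤⟨ +-monoˡ-≤ (N div p * p) (<⇒≤ (m%n<n N p)) ⟩
      p + N div p * p            ≡⟨ cong (p ℕ.+_) (*-comm (N div p) p) ⟩
      p + p * (N div p)          ≡˘⟨ *-suc p (N div p) ⟩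
      p * suc (N div p)          ≡⟨ cong (p *_) (+-comm 1 (N div p)) ⟩
      p * c                      ∎

    pc≤N+p : p * c ℕ.≤ N + p
    pc≤N+p = begin
      p * c                      ≡⟨ cong (p *_) (+-comm (N div p) 1) ⟩
      p * suc (N div p)          ≡⟨ *-suc p (N div p) ⟩
      p + p * (N div p)          ≡⟨ +-comm p _ ⟩
      p * (N div p) + p          ≤⟨ +-monoˡ-≤ p (≤-trans (≤-reflexive (*-comm p (N div p))) (m/n*n≤m N p)) ⟩
      N + p                      ∎

    agreement-bound : ∀ i → agreement (predictor i) g ℕ.≤ λ′ * n + c
    agreement-bound i = strictMono-reflects-≤ (2 ^_) (^-monoʳ-< 2 (s≤s (s≤s z≤n)))
      (*-cancelʳ-≤ (2 ^ agreement (predictor i) g) (2 ^ (λ′ * n + c)) (a ^ N) {{m^n≢0 a N}} (begin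
        2 ^ agreement (predictor i) g * a ^ N  ≤⟨ proj₂ (fewAgreements p predictor) i ⟩
        M * suc a ^ N                          ≤⟨ *-mono-≤ M≤ (blockRatio p c N N≤pc) ⟩
        2 ^ (λ′ * n) * (2 ^ c * a ^ N)         ≡˘⟨ *-assoc (2 ^ (λ′ * n)) (2 ^ c) (a ^ N) ⟩
        2 ^ (λ′ * n) * 2 ^ c * a ^ N           ≡˘⟨ cong (_* a ^ N) (^-distribˡ-+-* 2 (λ′ * n) c) ⟩
        2 ^ (λ′ * n + c) * a ^ N               ∎))

    families-small : 32 * p * p * e * suc S ℕ.≤ N
    families-small = strictMono-reflects-≤ (λ x → x * x) (λ x<y → *-mono-< x<y x<y) (begin
      (X * Y) * (X * Y)                ≡⟨ interchange X Y ⟩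
      (X * X) * (Y * Y)                ≤⟨ *-mono-≤ X²≤ Y²≤ ⟩
      (1024 * e ^ 6) * (16 * N)         ≡⟨ regroup (e ^ 6) N ⟩
      (2 ^ 14 * e ^ 6) * N              ≤⟨ *-monoˡ-≤ N poly ⟩
      N * N                            ∎)
      where
      X Y : ℕ
      X = 32 * p * p * e
      Y = suc S
      interchange : ∀ x y → (x * y) * (x * y) ≡ (x * x) * (y * y)
      interchange = solve-∀
      regroup : ∀ u v → (1024 * u) * (16 * v) ≡ (16384 * u) * v
      regroup = solve-∀
      expand : ∀ p e → (32 * p * p * e) * (32 * p * p * e) ≡ 1024 * (p * p * p * p) * (e * e)
      expand = solve-∀
      collect : ∀ x → 1024 * (x * x * x * x) * (x * x) ≡ 1024 * (x * (x * (x * (x * (x * (x * 1))))))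
      collect = solve-∀
      X²≤ : X * X ℕ.≤ 1024 * e ^ 6
      X²≤ = begin
        X * X                               ≡⟨ expand p e ⟩
        1024 * (p * p * p * p) * (e * e)     ≤⟨ *-monoˡ-≤ (e * e) (*-monoʳ-≤ 1024 (*-mono-≤ (*-mono-≤ (*-mono-≤ p≤e p≤e) p≤e) p≤e)) ⟩
        1024 * (e * e * e * e) * (e * e)     ≡⟨ collect e ⟩
        1024 * e ^ 6                        ∎
      doubleSquare : ∀ s → (s + s) * (s + s) ≡ 4 * (s * s)
      doubleSquare = solve-∀
      Y²≤ : Y * Y ℕ.≤ 16 * N
      Y²≤ = begin
        Y * Y                 ≤⟨ *-mono-≤ Y≤2S Y≤2S ⟩
        (S + S) * (S + S)     ≡⟨ doubleSquare S ⟩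
        4 * (S * S)           ≤⟨ *-monoʳ-≤ 4 S²≤2N ⟩
        4 * (2 * N)           ≤⟨ *-monoʳ-≤ 4 (*-monoˡ-≤ N (≤ᵇ⇒≤ 2 4 _)) ⟩
        4 * (4 * N)           ≡˘⟨ *-assoc 4 4 N ⟩
        16 * N                ∎
        where
        Y≤2S : Y ℕ.≤ S + S
        Y≤2S = +-monoˡ-≤ S (m^n>0 2 h)

    successes-bound : ∀ A → ComputableBySize2^n/8 A → successes A * n ℕ.≤ 256 * N
    successes-bound A computable = begin
      successes A * n                              ≤⟨ *-monoˡ-≤ n (≤-trans predicted (agreement-bound i)) ⟩
      (λ′ * n + c) * n                             ≡⟨ *-distribʳ-+ n (λ′ * n) c ⟩
      λ′ * n * n + c * n                           ≡⟨ cong₂ _+_ (family-term p S) (fourfold p c) ⟩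
      32 * p * p * e * suc S + 4 * (p * c)         ≤⟨ +-mono-≤ families-small (*-monoʳ-≤ 4 (≤-trans pc≤N+p (+-monoʳ-≤ N p≤N))) ⟩
      N + 4 * (N + N)                              ≤⟨ nine≤256 N ⟩
      256 * N                                      ∎
      where
      i : Fin M
      i = proj₁ (small-rule-predicted A computable)
      predicted : successes A ℕ.≤ agreement (predictor i) g
      predicted = proj₂ (small-rule-predicted A computable)
      family-term : ∀ p S → ((p + 3) + (p + 3)) * suc S * ((p + p) + (p + p)) * ((p + p) + (p + p))
                            ≡ 32 * p * p * (p + 3) * suc S
      family-term = solve-∀
      fourfold : ∀ p c → c * ((p + p) + (p + p)) ≡ 4 * (p * c)
      fourfold = solve-∀
      p≤N : p ℕ.≤ N
      p≤N = ≤-trans (m≤n*m p (16 * p)) 16p²≤N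
      nine : ∀ N → N + 4 * (N + N) + 247 * N ≡ 256 * N
      nine = solve-∀
      nine≤256 : ∀ N → N + 4 * (N + N) ℕ.≤ 256 * N
      nine≤256 N = ≤-trans (m≤m+n _ (247 * N)) (≤-reflexive (nine N))

  value-bound : ∀ A → ComputableBySize2^n/8 A → val D A ι ℚ.≤ (+ 256) / n
  value-bound A computable = subst (ℚ._≤ (+ 256) / n) (sym (val-successes A))
    (frac-≤ (successes A) 256 N-1 (pred n) (subst (λ z → successes A * n ℕ.≤ 256 * z) (sym 1+N-1≡N) cross))
    where
    quadruple : ∀ p → (p + p) + (p + p) ≡ 4 * p
    quadruple = solve-∀
    -- for p < 64 the trivial bound successes ≤ N suffices, as n ≤ 256
    small : ¬ 64 ℕ.≤ p → successes A * n ℕ.≤ 256 * N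
    small p≱64 = ≤-trans (*-monoˡ-≤ n (count≤2^r p (λ x → success A ι (arrival x (g x))))) (≤-trans (*-monoʳ-≤ N n≤256) (≤-reflexive (*-comm N 256)))
      where
      n≤256 : n ℕ.≤ 256
      n≤256 = subst (ℕ._≤ 256) (sym (quadruple p)) (*-monoʳ-≤ 4 (<⇒≤ (≰⇒> p≱64)))
    cross : successes A * n ℕ.≤ 256 * N
    cross = case 64 ≤? p of λ where
      (yes 64≤p) → Large.successes-bound 64≤p A computable
      (no  p≱64) → small p≱64

Claim : ℕ → ℕ → Set
Claim C n = (nz : NonZero n) → Σ (Dist n) λ D →
  (Σ (Rule n) λ A → val D A ι ≡ 1ℚ) ×
  ((A : Rule n) → ComputableBySize2^n/8 A → val D A ι ℚ.≤ ((+ C) / n) {{nz}})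

mainTheorem13 : Σ ℕ λ C → (k : ℕ) →
    Σ (Dist (4 * suc k)) λ D →
    (Σ (Rule (4 * suc k)) λ A → val D A ι ≡ 1ℚ) ×
    ((A : Rule (4 * suc k)) → ComputableBySize2^n/8 A →
    val D A ι ℚ.≤ (+ C) / (4 * suc k))
mainTheorem13 = 256 , λ k → subst (Claim 256) (quadruple (suc k)) (claim k) _
  where
  quadruple : ∀ p → (p + p) + (p + p) ≡ 4 * p
  quadruple = solve-∀
  claim : ∀ k → Claim 256 (Instance.n k)
  claim k _ = D , (informed g , informed-perfect) , value-bound
    where open Construction k
          open Instance k using (informed)
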